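{- Let $n,k$ be even integers with $1\le k<n/2$. Then $B(n,k)\ne C(n,k)$ if and only if $k^2\equiv\pm1\pmod{n/2}$. Moreover, if $k^2\equiv1\pmod{n/2}$ then $B(n,k)=\langle C(n,k),\lambda\rangle=\langle\rho,\delta,\beta,\lambda\rangle$, and if $k^2\equiv-1\pmod{n/2}$ then $B(n,k)=\langle C(n,k),\tau\rangle=\langle\rho,\delta,\beta,\tau\rangle$.
   Context: $\mathrm{DGP}(n,k)$ is the canonical double cover of the generalized Petersen graph $\mathrm{GP}(n,k)$: vertex set $\{(u_i,j),(v_i,j): 0\le i\le n-1, j\in\{0,1\}\}$, edges $\{(u_i,j),(u_{i+1},1-j)\}$ (outer edges $\mathcal{O}$), $\{(v_i,j),(v_{i+k},1-j)\}$ (inner edges $\mathcal{I}$), $\{(u_i,j),(v_i,1-j)\}$ (spokes $\mathcal{S}$), subscripts mod $n$. $A(n,k)=\mathrm{Aut}(\mathrm{DGP}(n,k))$; $B(n,k)$ is the setwise stabilizer of $\mathcal{S}$ in $A(n,k)$; $C(n,k)$ is the subgroup stabilizing each of $\mathcal{O},\mathcal{I},\mathcal{S}$ setwise. Permutations: $(u_i,j)^\rho=(u_{i+1},j)$, $(v_i,j)^\rho=(v_{i+1},j)$; $(u_i,j)^\delta=(u_{ -i},j)$, $(v_i,j)^\delta=(v_{ -i},j)$; $(u_i,j)^\beta=(u_i,1-j)$, $(v_i,j)^\beta=(v_i,1-j)$; $((u_i,j)^\lambda,(v_i,j)^\lambda)=((v_{1+(i-k)k},j),(u_{ik},j))$ if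 $i+j$ odd, $((v_{ik},j),(u_{1+(i-k)k},j))$ if $i+j$ even; $((u_i,j)^\tau,(v_i,j)^\tau)=((v_{ -1+(i-k)k},j),(u_{ik},j))$ if $i+j$ odd, $((v_{ik},j),(u_{ -1+(i-k)k},j))$ if $i+j$ even. -}

module Defs where

open import Data.Nat as ℕ using (ℕ; zero; suc)
open import Data.Integer as ℤ using (ℤ; +_; _%ℕ_)
open import Data.Integer.DivMod using (n%ℕd<d)
open import Data.Fin using (Fin; toℕ; fromℕ<)
open import Data.Bool using (Bool; true; false; not)
open import Data.Product using (_×_; _,_; Σ)
open import Data.Sum using (_⊎_)
open import Relation.Binary.PropositionalEquality using (_≡_)
open import Function.Bundles using (_⇔_)

-- Arithmetic on indices modulo n.
-- An index i : Fin n is shifted by an integer expression; the given index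
-- witnesses that n > 0, so reduction mod n is well defined.

reduce : {n : ℕ} → Fin n → ℤ → Fin n
reduce {suc n} _ z = fromℕ< (n%ℕd<d z (suc n))

iℤ : {n : ℕ} → Fin n → ℤ
iℤ i = + toℕ i

bit : Bool → ℕ
bit false = 0
bit true  = 1

-- Vertices of DGP(n,k): (u_i , j) and (v_i , j)

data Side : Set where
  U V : Side

Vtx : ℕ → Set
Vtx n = Side × Fin n × Bool

OE : (n : ℕ) → Vtx n → Vtx n → Set
OE n (s , i , j) (s' , i' , j') =
  s ≡ U × s' ≡ U × i' ≡ reduce i (iℤ i ℤ.+ + 1) × j' ≡ not j

IE : (n k : ℕ) → Vtx n → Vtx n → Set
IE n k (s , i , j) (s' , i' , j') =
  s ≡ V × s' ≡ V × i' ≡ reduce i (iℤ i ℤ.+ + k) × j' ≡ not j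

SE : (n : ℕ) → Vtx n → Vtx n → Set
SE n (s , i , j) (s' , i' , j') =
  s ≡ U × s' ≡ V × i' ≡ i × j' ≡ not j

Outer : (n : ℕ) → Vtx n → Vtx n → Set
Outer n x y = OE n x y ⊎ OE n y x

Inner : (n k : ℕ) → Vtx n → Vtx n → Set
Inner n k x y = IE n k x y ⊎ IE n k y x

Spoke : (n : ℕ) → Vtx n → Vtx n → Set
Spoke n x y = SE n x y ⊎ SE n y x

Adj : (n k : ℕ) → Vtx n → Vtx n → Set
Adj n k x y = Outer n x y ⊎ Inner n k x y ⊎ Spoke n x y

record Perm (A : Set) : Set where
  field
    to      : A → A
    from    : A → A
    from∘to : ∀ x → from (to x) ≡ x
    to∘from : ∀ x → to (from x) ≡ x
open Perm public

idP : {A : Set} → Perm A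
idP = record { to = λ x → x ; from = λ x → x
             ; from∘to = λ _ → Relation.Binary.PropositionalEquality.refl
             ; to∘from = λ _ → Relation.Binary.PropositionalEquality.refl }

-- composition: first σ, then π  (x^{σπ} = (x^σ)^π)
_·_ : {A : Set} → Perm A → Perm A → Perm A
σ · π = record
  { to = λ x → to π (to σ x)
  ; from = λ x → from σ (from π x)
  ; from∘to = λ x → Relation.Binary.PropositionalEquality.trans
        (Relation.Binary.PropositionalEquality.cong (from σ) (from∘to π (to σ x)))
        (from∘to σ x)
  ; to∘from = λ x → Relation.Binary.PropositionalEquality.trans
        (Relation.Binary.PropositionalEquality.cong (to π) (to∘from σ (from π x)))
        (to∘from π x) }

_⁻¹ : {A : Set} → Perm A → Perm A
σ ⁻¹ = record { to = from σ ; from = to σ ; from∘to = to∘from σ ; to∘from = from∘to σ }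

_≈_ : {A : Set} → Perm A → Perm A → Set
σ ≈ π = ∀ x → to σ x ≡ to π x

PermSet : Set → Set₁
PermSet A = Perm A → Set

data ⟨_⟩ {A : Set} (G : PermSet A) : PermSet A where
  gen  : ∀ {σ} → G σ → ⟨ G ⟩ σ
  one  : ⟨ G ⟩ idP
  mul  : ∀ {σ π} → ⟨ G ⟩ σ → ⟨ G ⟩ π → ⟨ G ⟩ (σ · π)
  inv  : ∀ {σ} → ⟨ G ⟩ σ → ⟨ G ⟩ (σ ⁻¹)
  ext  : ∀ {σ π} → ⟨ G ⟩ σ → σ ≈ π → ⟨ G ⟩ π

_∪_ : {A : Set} → PermSet A → PermSet A → PermSet A
(P ∪ Q) σ = P σ ⊎ Q σ

⟦_⟧ : {A : Set} → (A → A) → PermSet A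
⟦ f ⟧ σ = ∀ x → to σ x ≡ f x

_≐_ : {A : Set} → PermSet A → PermSet A → Set
P ≐ Q = ∀ σ → P σ ⇔ Q σ

Stabilises : {A : Set} → (A → A → Set) → Perm A → Set
Stabilises R σ = ∀ x y → R x y ⇔ R (to σ x) (to σ y)

A : (n k : ℕ) → PermSet (Vtx n)
A n k σ = Stabilises (Adj n k) σ

B : (n k : ℕ) → PermSet (Vtx n)
B n k σ = A n k σ × Stabilises (Spoke n) σ

C : (n k : ℕ) → PermSet (Vtx n)
C n k σ = A n k σ × Stabilises (Outer n) σ × Stabilises (Inner n k) σ
          × Stabilises (Spoke n) σ

ρ-map : (n : ℕ) → Vtx n → Vtx n
ρ-map n (s , i , j) = s , reduce i (iℤ i ℤ.+ + 1) , j

δ-map : (n : ℕ) → Vtx n → Vtx n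
δ-map n (s , i , j) = s , reduce i (ℤ.- iℤ i) , j

β-map : (n : ℕ) → Vtx n → Vtx n
β-map n (s , i , j) = s , i , not j

oddSum : {n : ℕ} → Fin n → Bool → Bool
oddSum i j with (toℕ i ℕ.+ bit j) ℕ.% 2
... | 0 = false
... | _ = true

-- e = +1 gives λ, e = -1 gives τ:
--   (u_i,j) ↦ (v_{e+(i-k)k}, j) if i+j odd, (v_{ik}, j) if i+j even
--   (v_i,j) ↦ (u_{ik}, j)       if i+j odd, (u_{e+(i-k)k}, j) if i+j even
twist : (n k : ℕ) → ℤ → Vtx n → Vtx n
twist n k e (s , i , j) = go s (oddSum i j)
  where
  a : Fin n
  a = reduce i (e ℤ.+ (iℤ i ℤ.- + k) ℤ.* + k)
  b : Fin n
  b = reduce i (iℤ i ℤ.* + k)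
  go : Side → Bool → Vtx n
  go U true  = V , a , j
  go U false = V , b , j
  go V true  = U , b , j
  go V false = U , a , j

λ-map : (n k : ℕ) → Vtx n → Vtx n
λ-map n k = twist n k (+ 1)

τ-map : (n k : ℕ) → Vtx n → Vtx n
τ-map n k = twist n k (ℤ.- + 1)

RDB+ : (n : ℕ) → (Vtx n → Vtx n) → PermSet (Vtx n)
RDB+ n g = ⟦ ρ-map n ⟧ ∪ (⟦ δ-map n ⟧ ∪ (⟦ β-map n ⟧ ∪ ⟦ g ⟧))

module Submission where

-- Outer edges join u-vertices, inner edges join
-- v-vertices and spokes join the two sides, so an element of B(n,k) maps non-spoke edges to non-spoke
-- edges; by connectivity it then either keeps every vertex on its side (and lies in C(n,k)) or swaps
-- the sides everywhere. C(n,k) is rigid: an edge-type-preserving injection fixing two adjacent outer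
-- vertices is the identity (this uses 4k ≢ 0 mod n), so C(n,k) consists of the maps
-- (s, i, j) ↦ (s, ±i + c, b + j), all generated by ρ, δ, β. A side-swapping σ maps an outer cycle to
-- a walk with constant inner step d = ±k; the images of the two inner neighbours v₀ and v₂ₖ of vₖ are
-- then distinct outer neighbours of one vertex, so 2kd ≡ ±2 (mod n), i.e. k² ≡ ±1 (mod n/2).
-- Conversely, when k² ≡ ±1 (mod n/2) the twist λ (resp. τ) exchanges outer and inner edges and
-- preserves spokes; its square lies in C(n,k), which makes it a permutation, and every side-swapping
-- σ equals (σλ)λ⁻¹ with σλ ∈ C(n,k).

open import Data.Nat as ℕ using (ℕ)
import Data.Nat.Properties as ℕ
open import Data.Bool using (Bool; true; false; not; _xor_)
open import Data.Product using (Σ; _×_; _,_; proj₁; proj₂)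
open import Data.Sum using (_⊎_; inj₁; inj₂)
open import Data.Empty using (⊥-elim)
open import Function.Base using (_∘_)
open import Function.Bundles using (_⇔_; mk⇔; Equivalence)
open import Relation.Nullary using (¬_)
open import Relation.Unary using (_⊆_; _∩_)
open import Relation.Binary.Core using (_Preserves_⟶_)
open import Relation.Binary.PropositionalEquality
open import Data.Integer using (ℤ; +_; 0ℤ)
open import Defs

module Congruence where

  import Data.Nat.DivMod as ℕ
  import Data.Nat.Divisibility as ℕ
  open import Data.Integer hiding (suc; _≤_; _<_)
  open import Data.Integer.DivMod using (n%ℕd<d; a≡a%ℕn+[a/ℕn]*n)
  import Data.Integer.Properties as ℤ
  open import Data.Integer.Divisibility.Signed using (divides; ∣⇒∣ᵤ; ∣ᵤ⇒∣)
  open import Data.Integer.Tactic.RingSolver using (solve; solve-∀)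
  open import Data.List using (_∷_; [])
  open import Relation.Binary.Bundles using (Setoid)

  infix 4 _≡_mod_

  record _≡_mod_ (a b D : ℤ) : Set where
    constructor _,_
    field
      quotient : ℤ
      equation : a ≡ b + quotient * D

  module _ {D : ℤ} where

    mod-refl : ∀ {a} → a ≡ a mod D
    mod-refl {a} = 0ℤ , solve (a ∷ D ∷ [])

    mod-reflexive : ∀ {a b} → a ≡ b → a ≡ b mod D
    mod-reflexive refl = mod-refl

    mod-sym : ∀ {a b} → a ≡ b mod D → b ≡ a mod D
    mod-sym {b = b} (q , refl) = - q , solve (b ∷ q ∷ D ∷ [])

    mod-trans : ∀ {a b c} → a ≡ b mod D → b ≡ c mod D → a ≡ c mod D
    mod-trans {c = c} (q , refl) (r , refl) = r + q , solve (c ∷ r ∷ q ∷ D ∷ [])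

    mod-setoid : Setoid _ _
    mod-setoid = record
      { Carrier = ℤ ; _≈_ = λ a b → a ≡ b mod D
      ; isEquivalence = record { refl = mod-refl ; sym = mod-sym ; trans = mod-trans } }

    +-mod-cong : ∀ {a b c d} → a ≡ b mod D → c ≡ d mod D → a + c ≡ b + d mod D
    +-mod-cong {b = b} {d = d} (q , refl) (r , refl) = q + r , solve (b ∷ d ∷ q ∷ r ∷ D ∷ [])

    *-mod-congˡ : ∀ c {a b} → a ≡ b mod D → c * a ≡ c * b mod D
    *-mod-congˡ c {b = b} (q , refl) = c * q , solve (c ∷ b ∷ q ∷ D ∷ [])

    *-mod-congʳ : ∀ c {a b} → a ≡ b mod D → a * c ≡ b * c mod D
    *-mod-congʳ c {b = b} (q , refl) = q * c , solve (c ∷ b ∷ q ∷ D ∷ [])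

    neg-mod-cong : ∀ {a b} → a ≡ b mod D → - a ≡ - b mod D
    neg-mod-cong {b = b} (q , refl) = - q , solve (b ∷ q ∷ D ∷ [])

    ≡+⇒≡- : ∀ {a b} c → b ≡ a + c mod D → a ≡ b - c mod D
    ≡+⇒≡- {a} c (q , refl) = - q , solve (a ∷ c ∷ q ∷ D ∷ [])

    ≡-⇒≡+ : ∀ {a b} c → b ≡ a - c mod D → a ≡ b + c mod D
    ≡-⇒≡+ {a} c (q , refl) = - q , solve (a ∷ c ∷ q ∷ D ∷ [])

    m-n≡0⇒m≡n-mod : ∀ {a b} → a - b ≡ 0ℤ mod D → a ≡ b mod D
    m-n≡0⇒m≡n-mod {a} {b} (q , e) = q , (begin
      a                     ≡⟨ solve (a ∷ b ∷ []) ⟩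
      b + (a - b)           ≡⟨ cong (λ z → b + z) e ⟩
      b + (0ℤ + q * D)      ≡⟨ solve (b ∷ q ∷ D ∷ []) ⟩
      b + q * D             ∎)
      where open ≡-Reasoning

    m≡n⇒m-n≡0-mod : ∀ {a b} → a ≡ b mod D → a - b ≡ 0ℤ mod D
    m≡n⇒m-n≡0-mod {b = b} (q , refl) = q , solve (b ∷ q ∷ D ∷ [])

    +-mod-cancelʳ : ∀ {a b} c → a + c ≡ b + c mod D → a ≡ b mod D
    +-mod-cancelʳ {a} {b} c h = begin
      a            ≡⟨ solve (a ∷ c ∷ []) ⟩
      a + c - c    ≈⟨ +-mod-cong h mod-refl ⟩
      b + c - c    ≡⟨ solve (b ∷ c ∷ []) ⟩
      b            ∎
      where open import Relation.Binary.Reasoning.Setoid mod-setoid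

  mod-weaken : ∀ {D E a b} → a ≡ b mod D * E → a ≡ b mod D
  mod-weaken {D} {E} {b = b} (q , refl) = q * E , solve (b ∷ q ∷ D ∷ E ∷ [])

  mod-halve : ∀ {H a b} → a * + 2 ≡ b * + 2 mod + 2 * H → a ≡ b mod H
  mod-halve {H} {a} {b} (q , e) = q , ℤ.*-cancelʳ-≡ _ _ (+ 2) (trans e (solve (b ∷ q ∷ H ∷ [])))

  -- The two remainders differ by a multiple of d, and by less than d.
  %ℕ-mod-cong : ∀ d .{{_ : ℕ.NonZero d}} {a b} → a ≡ b mod + d → a %ℕ d ≡ b %ℕ d
  %ℕ-mod-cong d {a} {b} (q , e) = ra≡rb
    where
    ra = a %ℕ d
    rb = b %ℕ d
    qa = a /ℕ d
    qb = b /ℕ d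
    Q = qb + q - qa
    ra-rb≡Qd : + ra - + rb ≡ Q * + d
    ra-rb≡Qd = begin
      + ra - + rb                          ≡⟨ add-sub (+ ra) (+ rb) (qa * + d) ⟩
      (+ ra + qa * + d) - + rb - qa * + d  ≡⟨ cong (λ z → z - + rb - qa * + d) (a≡a%ℕn+[a/ℕn]*n a d) ⟨
      a - + rb - qa * + d                  ≡⟨ cong (λ z → z - + rb - qa * + d) e ⟩
      b + q * + d - + rb - qa * + d        ≡⟨ cong (λ z → z + q * + d - + rb - qa * + d) (a≡a%ℕn+[a/ℕn]*n b d) ⟩
      + rb + qb * + d + q * + d - + rb - qa * + d ≡⟨ collect (+ rb) qb q qa (+ d) ⟩
      Q * + d                              ∎
      where
      open ≡-Reasoning
      add-sub : ∀ x y z → x - y ≡ x + z - y - z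
      add-sub = solve-∀
      collect : ∀ r x y z w → r + x * w + y * w - r - z * w ≡ (x + y - z) * w
      collect = solve-∀
    ∣ra⊖rb∣≡ : ∣ ra ⊖ rb ∣ ≡ ∣ Q ∣ ℕ.* d
    ∣ra⊖rb∣≡ = trans (cong ∣_∣ (trans (sym (ℤ.m-n≡m⊖n ra rb)) ra-rb≡Qd)) (ℤ.∣i*j∣≡∣i∣*∣j∣ Q (+ d))
    ∣ra⊖rb∣<d : ∣ ra ⊖ rb ∣ ℕ.< d
    ∣ra⊖rb∣<d = ℕ.≤-<-trans (ℤ.∣m⊝n∣≤m⊔n ra rb) (ℕ.⊔-lub (n%ℕd<d a d) (n%ℕd<d b d))
    ra≡rb : ra ≡ rb
    ra≡rb with ∣ Q ∣ in ∣Q∣≡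
    ... | ℕ.zero  = ℤ.+-injective (ℤ.i-j≡0⇒i≡j (+ ra) (+ rb)
                    (trans (ℤ.m-n≡m⊖n ra rb) (ℤ.∣i∣≡0⇒i≡0 (trans ∣ra⊖rb∣≡ (cong (ℕ._* d) ∣Q∣≡)))))
    ... | ℕ.suc t = ⊥-elim (ℕ.<-irrefl refl (ℕ.<-≤-trans ∣ra⊖rb∣<d
                    (subst (d ℕ.≤_) (sym (trans ∣ra⊖rb∣≡ (cong (ℕ._* d) ∣Q∣≡))) (ℕ.m≤m+n d (t ℕ.* d)))))

  mod-%ℕ : ∀ d .{{_ : ℕ.NonZero d}} a → a ≡ + (a %ℕ d) mod + d
  mod-%ℕ d a = a /ℕ d , a≡a%ℕn+[a/ℕn]*n a d

  positive<mod⇒≢0 : ∀ d .{{_ : ℕ.NonZero d}} {a} → 0 ℕ.< a → a ℕ.< d → ¬ + a ≡ 0ℤ mod + d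
  positive<mod⇒≢0 d@(ℕ.suc _) {a} 0<a a<d c = ℕ.<-irrefl (sym a≡0) 0<a
    where
    a≡0 : a ≡ 0
    a≡0 = trans (sym (ℕ.m<n⇒m%n≡m a<d)) (trans (%ℕ-mod-cong d c) (ℕ.m<n⇒m%n≡m (ℕ.s≤s ℕ.z≤n)))

  isOdd : ℤ → Bool
  isOdd a = not (a %ℕ 2 ℕ.≡ᵇ 0)

  isOdd-mod-cong : ∀ {a b} → a ≡ b mod + 2 → isOdd a ≡ isOdd b
  isOdd-mod-cong c = cong (λ r → not (r ℕ.≡ᵇ 0)) (%ℕ-mod-cong 2 c)

  ≡bit-isOdd-mod2 : ∀ a → a ≡ + bit (isOdd a) mod + 2
  ≡bit-isOdd-mod2 a with a %ℕ 2 | n%ℕd<d a 2 | mod-%ℕ 2 a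
  ... | 0 | _ | c = c
  ... | 1 | _ | c = c
  ... | ℕ.suc (ℕ.suc _) | ℕ.s≤s (ℕ.s≤s ()) | _

  isOdd-injective-mod2 : ∀ {a b} → isOdd a ≡ isOdd b → a ≡ b mod + 2
  isOdd-injective-mod2 {a} {b} e =
    mod-trans (≡bit-isOdd-mod2 a) (subst (λ p → + bit p ≡ b mod + 2) (sym e) (mod-sym (≡bit-isOdd-mod2 b)))

  isOdd-+-even : ∀ {a} b {d} → a ≡ b + d mod + 2 → d ≡ 0ℤ mod + 2 → isOdd a ≡ isOdd b
  isOdd-+-even b c z =
    isOdd-mod-cong (mod-trans c (mod-trans (+-mod-cong (mod-refl {a = b}) z) (mod-reflexive (ℤ.+-identityʳ b))))

  isOdd-+-odd : ∀ {a} b {d} → a ≡ b + d mod + 2 → d ≡ 1ℤ mod + 2 → isOdd a ≡ not (isOdd b)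
  isOdd-+-odd b c z with isOdd b | ≡bit-isOdd-mod2 b
  ... | false | b≡0 = isOdd-mod-cong {b = 1ℤ} (mod-trans c (+-mod-cong b≡0 z))
  ... | true  | b≡1 = isOdd-mod-cong {b = 0ℤ} (mod-trans c (mod-trans (+-mod-cong b≡1 z) (1ℤ , refl)))

  bit-not-mod2 : ∀ j → + bit (not j) ≡ + bit j + 1ℤ mod + 2
  bit-not-mod2 false = mod-refl
  bit-not-mod2 true  = -1ℤ , refl

  mod-double : ∀ {H a b} → a ≡ b mod H → a * + 2 ≡ b * + 2 mod + 2 * H
  mod-double {H} {b = b} (q , refl) = q , solve (b ∷ q ∷ H ∷ [])

  unit-cancel : ∀ {H K e d} → K * K ≡ e mod H → e * e ≡ 1ℤ → d * K ≡ 0ℤ mod H → d ≡ 0ℤ mod H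
  unit-cancel {H} {K} {e} {d} k²≡e e²≡1 dK≡0 = begin
    d                ≡⟨ trans (sym (ℤ.*-identityʳ d)) (cong (d *_) (sym e²≡1)) ⟩
    d * (e * e)      ≈⟨ *-mod-congˡ d (*-mod-congʳ e (mod-sym k²≡e)) ⟩
    d * (K * K * e)  ≡⟨ regroup d K e ⟩
    (d * K) * K * e  ≈⟨ *-mod-congʳ e (*-mod-congʳ K dK≡0) ⟩
    0ℤ * K * e       ≡⟨ solve (K ∷ e ∷ []) ⟩
    0ℤ               ∎
    where
    open import Relation.Binary.Reasoning.Setoid (mod-setoid {H})
    regroup : ∀ d K e → d * (K * K * e) ≡ (d * K) * K * e
    regroup = solve-∀

  even-unit-cancel : ∀ {H K e d} → K * K ≡ e mod H → e * e ≡ 1ℤ →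
                     d * K ≡ 0ℤ mod + 2 * H → d ≡ 0ℤ mod + 2 → d ≡ 0ℤ mod + 2 * H
  even-unit-cancel {H} {K} {d = d} k²≡e e²≡1 dK≡0 (q , d≡2q) = mod-trans (mod-reflexive d≡q2) (mod-double q≡0)
    where
    d≡q2 : d ≡ q * + 2
    d≡q2 = trans d≡2q (ℤ.+-identityˡ (q * + 2))
    qK≡0 : q * K ≡ 0ℤ mod H
    qK≡0 = mod-halve (subst (λ z → z ≡ 0ℤ * + 2 mod + 2 * H) (regroup q K)
                            (subst (λ z → z * K ≡ 0ℤ mod + 2 * H) d≡q2 dK≡0))
      where
      regroup : ∀ q K → q * + 2 * K ≡ q * K * + 2
      regroup = solve-∀
    q≡0 : q ≡ 0ℤ mod H
    q≡0 = unit-cancel k²≡e e²≡1 qK≡0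

  +-mod-cancelˡ : ∀ {D} a {b c} → a + b ≡ a + c mod D → b ≡ c mod D
  +-mod-cancelˡ a {b} {c} h =
    +-mod-cancelʳ a (mod-trans (mod-reflexive (ℤ.+-comm b a)) (mod-trans h (mod-reflexive (ℤ.+-comm a c))))

  ≡0-mod⇔∣ : ∀ {h x} → x ≡ 0ℤ mod + h ⇔ h ℕ.∣ ∣ x ∣
  ≡0-mod⇔∣ {h} {x} = mk⇔ (λ (q , e) → ∣⇒∣ᵤ (divides q (trans e (ℤ.+-identityˡ _)))) multiple
    where
    multiple : h ℕ.∣ ∣ x ∣ → x ≡ 0ℤ mod + h
    multiple d with ∣ᵤ⇒∣ {+ h} {x} d
    ... | divides q e = q , trans e (sym (ℤ.+-identityˡ _))

  ≡-mod⇔∣∸ : ∀ {h a b} → b ℕ.≤ a → + a ≡ + b mod + h ⇔ h ℕ.∣ a ℕ.∸ b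
  ≡-mod⇔∣∸ {h} {a} {b} b≤a = mk⇔
    (λ c → subst (h ℕ.∣_) ∣a-b∣≡ (Equivalence.to ≡0-mod⇔∣ (m≡n⇒m-n≡0-mod c)))
    (λ d → m-n≡0⇒m≡n-mod (Equivalence.from ≡0-mod⇔∣ (subst (h ℕ.∣_) (sym ∣a-b∣≡) d)))
    where
    ∣a-b∣≡ : ∣ + a - + b ∣ ≡ a ℕ.∸ b
    ∣a-b∣≡ = cong ∣_∣ (trans (ℤ.m-n≡m⊖n a b) (ℤ.⊖-≥ b≤a))

  ≡-mod⇔∣+ : ∀ {h a b} → + a ≡ - + b mod + h ⇔ h ℕ.∣ a ℕ.+ b
  ≡-mod⇔∣+ {h} {a} {b} = mk⇔
    (λ c → subst (h ℕ.∣_) ∣a+b∣≡ (Equivalence.to ≡0-mod⇔∣ (m≡n⇒m-n≡0-mod c)))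
    (λ d → m-n≡0⇒m≡n-mod (Equivalence.from ≡0-mod⇔∣ (subst (h ℕ.∣_) (sym ∣a+b∣≡) d)))
    where
    ∣a+b∣≡ : ∣ + a - - + b ∣ ≡ a ℕ.+ b
    ∣a+b∣≡ = cong (λ z → ∣ + a + z ∣) (ℤ.neg-involutive (+ b))

open Congruence using (_≡_mod_)

module Signs where

  open import Data.Integer hiding (suc; _≤_; _<_)
  import Data.Integer.Properties as ℤ

  ±1 : Bool → ℤ
  ±1 false = 1ℤ
  ±1 true  = -1ℤ

  ±1-square : ∀ f → ±1 f * ±1 f ≡ 1ℤ
  ±1-square false = refl
  ±1-square true  = refl

  ±1-xor : ∀ f g → ±1 (f xor g) ≡ ±1 f * ±1 g
  ±1-xor false g     = sym (ℤ.*-identityˡ (±1 g))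
  ±1-xor true  false = refl
  ±1-xor true  true  = refl

  bool-dichotomy : ∀ a b → b ≡ a ⊎ b ≡ not a
  bool-dichotomy false false = inj₁ refl
  bool-dichotomy false true  = inj₂ refl
  bool-dichotomy true  false = inj₂ refl
  bool-dichotomy true  true  = inj₁ refl

module Sides where

  opp : Side → Side
  opp U = V
  opp V = U

  opp-injective : ∀ {s s′} → opp s ≡ opp s′ → s ≡ s′
  opp-injective {U} {U} _ = refl
  opp-injective {V} {V} _ = refl

  opp-involutive : ∀ s → opp (opp s) ≡ s
  opp-involutive U = refl
  opp-involutive V = refl

  relative : Side → Side → Side
  relative U s = s
  relative V s = opp s

  relative-opp : ∀ s t → relative (opp s) (opp t) ≡ relative s t
  relative-opp U t = opp-involutive t
  relative-opp V t = refl

  relative-U : ∀ s t → relative s t ≡ U → t ≡ s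
  relative-U U U _ = refl
  relative-U V V _ = refl

  relative-V : ∀ s t → relative s t ≡ V → t ≡ opp s
  relative-V U V _ = refl
  relative-V V U _ = refl

  opp-≢ : ∀ s → ¬ s ≡ opp s
  opp-≢ U ()
  opp-≢ V ()

module Permutations where

  module _ {X : Set} {R : X → X → Set} where

    preserves⇒stabilises : (σ : Perm X) → to σ Preserves R ⟶ R → from σ Preserves R ⟶ R → Stabilises R σ
    preserves⇒stabilises σ f g x y = mk⇔ f (λ r → subst₂ R (from∘to σ x) (from∘to σ y) (g r))

    stabilises⇒preserves : (σ : Perm X) → Stabilises R σ → to σ Preserves R ⟶ R
    stabilises⇒preserves σ s = Equivalence.to (s _ _)

    stabilises⇒from-preserves : (σ : Perm X) → Stabilises R σ → from σ Preserves R ⟶ R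
    stabilises⇒from-preserves σ s {x} {y} r =
      Equivalence.from (s (from σ x) (from σ y)) (subst₂ R (sym (to∘from σ x)) (sym (to∘from σ y)) r)

  record SubgroupClosed {X : Set} (P : PermSet X) : Set where
    field
      one-closed : P idP
      ·-closed   : ∀ {σ π} → P σ → P π → P (σ · π)
      ⁻¹-closed  : ∀ {σ} → P σ → P (σ ⁻¹)
      ≈-closed   : ∀ {σ π} → P σ → σ ≈ π → P π
  open SubgroupClosed

  module _ {X : Set} where

    ⟨⟩-least : ∀ {G P : PermSet X} → SubgroupClosed P → G ⊆ P → ⟨ G ⟩ ⊆ P
    ⟨⟩-least c G⊆P (gen g)   = G⊆P g
    ⟨⟩-least c G⊆P one       = one-closed c
    ⟨⟩-least c G⊆P (mul a b) = ·-closed c (⟨⟩-least c G⊆P a) (⟨⟩-least c G⊆P b)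
    ⟨⟩-least c G⊆P (inv a)   = ⁻¹-closed c (⟨⟩-least c G⊆P a)
    ⟨⟩-least c G⊆P (ext a e) = ≈-closed c (⟨⟩-least c G⊆P a) e

    stabiliser-closed : ∀ R → SubgroupClosed (Stabilises {X} R)
    stabiliser-closed R = record
      { one-closed = λ x y → mk⇔ (λ r → r) (λ r → r)
      ; ·-closed   = λ s t x y → mk⇔ (λ r → Equivalence.to (t _ _) (Equivalence.to (s x y) r))
                                     (λ r → Equivalence.from (s x y) (Equivalence.from (t _ _) r))
      ; ⁻¹-closed  = λ {σ} s → preserves⇒stabilises {R = R} (σ ⁻¹)
                                 (stabilises⇒from-preserves σ s) (stabilises⇒preserves σ s)
      ; ≈-closed   = λ s e x y → mk⇔ (λ r → subst₂ R (e x) (e y) (Equivalence.to (s x y) r))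
                                     (λ r → Equivalence.from (s x y) (subst₂ R (sym (e x)) (sym (e y)) r))
      }

    ∩-closed : ∀ {P Q : PermSet X} → SubgroupClosed P → SubgroupClosed Q → SubgroupClosed (P ∩ Q)
    ∩-closed cP cQ = record
      { one-closed = one-closed cP , one-closed cQ
      ; ·-closed   = λ (p , q) (p′ , q′) → ·-closed cP p p′ , ·-closed cQ q q′
      ; ⁻¹-closed  = λ (p , q) → ⁻¹-closed cP p , ⁻¹-closed cQ q
      ; ≈-closed   = λ (p , q) e → ≈-closed cP p e , ≈-closed cQ q e
      }

  B-closed : ∀ n k → SubgroupClosed (B n k)
  B-closed n k = ∩-closed (stabiliser-closed (Adj n k)) (stabiliser-closed (Spoke n))

  C⊆B : ∀ {n k} → C n k ⊆ B n k
  C⊆B (a , _ , _ , s) = a , s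

module Coordinates (m : ℕ) where

  open import Data.Fin using (Fin; toℕ; fromℕ<)
  import Data.Fin.Properties as Fin
  import Data.Nat.DivMod as ℕ
  open import Data.Bool.Properties using (not-involutive)
  open import Data.Integer hiding (suc; _≤_; _<_)
  import Data.Integer.Properties as ℤ
  open import Data.Integer.DivMod using (n%ℕd<d)
  open Congruence
  open Sides

  n : ℕ
  n = ℕ.suc m

  N : ℤ
  N = + n

  toFin : ℤ → Fin n
  toFin z = fromℕ< (n%ℕd<d z n)

  toFin-mod : ∀ z → iℤ (toFin z) ≡ z mod N
  toFin-mod z = subst (λ r → + r ≡ z mod N) (sym (Fin.toℕ-fromℕ< (n%ℕd<d z n))) (mod-sym (mod-%ℕ n z))

  toFin-mod-cong : ∀ {a b} → a ≡ b mod N → toFin a ≡ toFin b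
  toFin-mod-cong {a} {b} c = Fin.toℕ-injective
    (trans (Fin.toℕ-fromℕ< _) (trans (%ℕ-mod-cong n c) (sym (Fin.toℕ-fromℕ< _))))

  toFin-injective-mod : ∀ {a b} → toFin a ≡ toFin b → a ≡ b mod N
  toFin-injective-mod {a} {b} e =
    mod-trans (mod-sym (toFin-mod a)) (subst (λ i → iℤ i ≡ b mod N) (sym e) (toFin-mod b))

  toFin-iℤ : ∀ (i : Fin n) → toFin (iℤ i) ≡ i
  toFin-iℤ i = Fin.toℕ-injective (trans (Fin.toℕ-fromℕ< _) (ℕ.m<n⇒m%n≡m (Fin.toℕ<n i)))

  Vx : Set
  Vx = Vtx n

  side : Vx → Side
  side (s , _ , _) = s

  idx : Vx → ℤ
  idx (_ , i , _) = iℤ i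

  layer : Vx → Bool
  layer (_ , _ , j) = j

  vtx : Side → ℤ → Bool → Vx
  vtx s a j = s , toFin a , j

  vtx-mod-cong : ∀ s {a b} j → a ≡ b mod N → vtx s a j ≡ vtx s b j
  vtx-mod-cong s j c = cong (λ i → s , i , j) (toFin-mod-cong c)

  vtx-η : ∀ x → vtx (side x) (idx x) (layer x) ≡ x
  vtx-η (s , i , j) = cong (λ i′ → s , i′ , j) (toFin-iℤ i)

  idx-vtx : ∀ s a j → idx (vtx s a j) ≡ a mod N
  idx-vtx s a j = toFin-mod a

  idx-vtx-injective : ∀ {s s′ a a′ j j′} → vtx s a j ≡ vtx s′ a′ j′ → a ≡ a′ mod N
  idx-vtx-injective e = toFin-injective-mod (cong (λ x → proj₁ (proj₂ x)) e)

  vertex-≡ : ∀ {x y} → side x ≡ side y → idx x ≡ idx y mod N → layer x ≡ layer y → x ≡ y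
  vertex-≡ {x} {y} refl c refl =
    trans (sym (vtx-η x)) (trans (vtx-mod-cong (side x) (layer x) c) (vtx-η y))

  ≡-vtx : ∀ {z} s a j → side z ≡ s → idx z ≡ a mod N → layer z ≡ j → z ≡ vtx s a j
  ≡-vtx {z} s a j refl e refl = vertex-≡ {z} {vtx s a j} refl (mod-trans e (mod-sym (idx-vtx s a j))) refl

  idx-cong : ∀ {x y} → x ≡ y → idx x ≡ idx y mod N
  idx-cong refl = mod-refl

  data ±-Related (c a b : ℤ) : Set where
    plus  : b ≡ a + c mod N → ±-Related c a b
    minus : b ≡ a - c mod N → ±-Related c a b

  Step : ℤ → Vx → Vx → Set
  Step c x y = layer y ≡ not (layer x) × ±-Related c (idx x) (idx y)

  not-flip : ∀ {a b} → b ≡ not a → a ≡ not b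
  not-flip {a} e = trans (sym (not-involutive a)) (cong not (sym e))

  module _ {x y : Vx} where

    OE⇒ : OE n x y → side x ≡ U × side y ≡ U × layer y ≡ not (layer x) × (idx y ≡ idx x + 1ℤ mod N)
    OE⇒ (refl , refl , refl , refl) = refl , refl , refl , toFin-mod _

    ⇒OE : side x ≡ U → side y ≡ U → layer y ≡ not (layer x) → idx y ≡ idx x + 1ℤ mod N → OE n x y
    ⇒OE refl refl refl c = refl , refl , trans (sym (toFin-iℤ _)) (toFin-mod-cong c) , refl

    IE⇒ : ∀ {k} → IE n k x y →
          side x ≡ V × side y ≡ V × layer y ≡ not (layer x) × (idx y ≡ idx x + + k mod N)
    IE⇒ (refl , refl , refl , refl) = refl , refl , refl , toFin-mod _

    ⇒IE : ∀ {k} → side x ≡ V → side y ≡ V → layer y ≡ not (layer x) → idx y ≡ idx x + + k mod N →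
          IE n k x y
    ⇒IE refl refl refl c = refl , refl , trans (sym (toFin-iℤ _)) (toFin-mod-cong c) , refl

    SE⇒ : SE n x y → side x ≡ U × side y ≡ V × layer y ≡ not (layer x) × (idx y ≡ idx x mod N)
    SE⇒ (refl , refl , refl , refl) = refl , refl , refl , mod-refl

    ⇒SE : side x ≡ U → side y ≡ V → layer y ≡ not (layer x) → idx y ≡ idx x mod N → SE n x y
    ⇒SE refl refl refl c = refl , refl , trans (sym (toFin-iℤ _)) (trans (toFin-mod-cong c) (toFin-iℤ _)) , refl

  Outer⇒ : ∀ {x y} → Outer n x y → side x ≡ U × side y ≡ U × Step 1ℤ x y
  Outer⇒ {x} {y} (inj₁ e) with OE⇒ {x} {y} e
  ... | sx , sy , l , c = sx , sy , l , plus c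
  Outer⇒ {x} {y} (inj₂ e) with OE⇒ {y} {x} e
  ... | sy , sx , l , c = sx , sy , not-flip l , minus (≡+⇒≡- 1ℤ c)

  ⇒Outer : ∀ {x y} → side x ≡ U → side y ≡ U → Step 1ℤ x y → Outer n x y
  ⇒Outer {x} {y} sx sy (l , plus c) = inj₁ (⇒OE {x} {y} sx sy l c)
  ⇒Outer {x} {y} sx sy (l , minus c) = inj₂ (⇒OE {y} {x} sy sx (not-flip l) (≡-⇒≡+ 1ℤ c))

  Inner⇒ : ∀ {k x y} → Inner n k x y → side x ≡ V × side y ≡ V × Step (+ k) x y
  Inner⇒ {k} {x} {y} (inj₁ e) with IE⇒ {x} {y} {k} e
  ... | sx , sy , l , c = sx , sy , l , plus c
  Inner⇒ {k} {x} {y} (inj₂ e) with IE⇒ {y} {x} {k} e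
  ... | sy , sx , l , c = sx , sy , not-flip l , minus (≡+⇒≡- (+ k) c)

  ⇒Inner : ∀ {k x y} → side x ≡ V → side y ≡ V → Step (+ k) x y → Inner n k x y
  ⇒Inner {k} {x} {y} sx sy (l , plus c) = inj₁ (⇒IE {x} {y} {k} sx sy l c)
  ⇒Inner {k} {x} {y} sx sy (l , minus c) = inj₂ (⇒IE {y} {x} {k} sy sx (not-flip l) (≡-⇒≡+ (+ k) c))

  Spoke⇒ : ∀ {x y} → Spoke n x y → side y ≡ opp (side x) × layer y ≡ not (layer x) × (idx y ≡ idx x mod N)
  Spoke⇒ {x} {y} (inj₁ e) with SE⇒ {x} {y} e
  ... | refl , sy , l , c = sy , l , c
  Spoke⇒ {x} {y} (inj₂ e) with SE⇒ {y} {x} e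
  ... | sy , refl , l , c = sy , not-flip l , mod-sym c

  ⇒Spoke : ∀ {x y} → side y ≡ opp (side x) → layer y ≡ not (layer x) → idx y ≡ idx x mod N → Spoke n x y
  ⇒Spoke {x@(U , _)} {y} s l c = inj₁ (⇒SE {x} {y} refl s l c)
  ⇒Spoke {x@(V , _)} {y} s l c = inj₂ (⇒SE {y} {x} s refl (not-flip l) (mod-sym c))

  ±-Related-resp : ∀ {c a a′ b b′} → a ≡ a′ mod N → b ≡ b′ mod N → ±-Related c a′ b′ → ±-Related c a b
  ±-Related-resp {c} a≡ b≡ (plus r)  =
    plus (mod-trans b≡ (mod-trans r (+-mod-cong (mod-sym a≡) (mod-refl {a = c}))))
  ±-Related-resp {c} a≡ b≡ (minus r) =
    minus (mod-trans b≡ (mod-trans r (+-mod-cong (mod-sym a≡) (mod-refl {a = - c}))))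

  ±-Related-neg : ∀ {c a b} → ±-Related c a b → ±-Related (- c) a b
  ±-Related-neg {c} {a} (plus r)  =
    minus (mod-trans r (+-mod-cong (mod-refl {a = a}) (mod-reflexive (sym (ℤ.neg-involutive c)))))
  ±-Related-neg         (minus r) = plus r

module AffineMaps (m k : ℕ) where

  open import Data.Fin using (toℕ)
  open import Data.Bool.Properties using (not-distribʳ-xor; xor-assoc; xor-comm; xor-same; xor-identityʳ)
  open import Data.Integer hiding (suc; _≤_; _<_)
  import Data.Integer.Properties as ℤ
  open import Data.Integer.Tactic.RingSolver using (solve-∀)
  open Congruence
  open Signs
  open Permutations

  open Coordinates m public

  preserves-Adj : ∀ {f : Vx → Vx} → f Preserves Outer n ⟶ Outer n → f Preserves Inner n k ⟶ Inner n k →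
                  f Preserves Spoke n ⟶ Spoke n → f Preserves Adj n k ⟶ Adj n k
  preserves-Adj o i s (inj₁ r)        = inj₁ (o r)
  preserves-Adj o i s (inj₂ (inj₁ r)) = inj₂ (inj₁ (i r))
  preserves-Adj o i s (inj₂ (inj₂ r)) = inj₂ (inj₂ (s r))

  -- By edge-type-preserving⇒affine these maps make up all of C(n,k).
  affine : Bool → Bool → ℤ → Vx → Vx
  affine f b c x = vtx (side x) (±1 f * idx x + c) (b xor layer x)

  idx-affine : ∀ f b c x → idx (affine f b c x) ≡ ±1 f * idx x + c mod N
  idx-affine f b c x = toFin-mod _

  affine-mod-cong : ∀ f b {c c′} x → c ≡ c′ mod N → affine f b c x ≡ affine f b c′ x
  affine-mod-cong f b x e = vtx-mod-cong (side x) _ (+-mod-cong (mod-refl {a = ±1 f * idx x}) e)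

  affine-shift : ∀ f d c {a b e} → b ≡ a + c mod N → ±1 f * c ≡ e → ±1 f * b + d ≡ (±1 f * a + d) + e mod N
  affine-shift f d c {a} r refl =
    mod-trans (+-mod-cong (*-mod-congˡ (±1 f) r) mod-refl) (mod-reflexive (distrib (±1 f) a c d))
    where
    distrib : ∀ s a c d → s * (a + c) + d ≡ (s * a + d) + s * c
    distrib = solve-∀

  affine-±-Related : ∀ f d {c a b} → ±-Related c a b → ±-Related c (±1 f * a + d) (±1 f * b + d)
  affine-±-Related false d {c} {a} (plus r) = plus (affine-shift false d c {a} r (ℤ.*-identityˡ c))
  affine-±-Related false d {c} {a} (minus r) = minus (affine-shift false d (- c) {a} r (ℤ.*-identityˡ (- c)))
  affine-±-Related true  d {c} {a} (plus r) = minus (affine-shift true d c {a} r (ℤ.-1*i≡-i c))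
  affine-±-Related true  d {c} {a} (minus r) =
    plus (affine-shift true d (- c) {a} r (trans (ℤ.-1*i≡-i (- c)) (ℤ.neg-involutive c)))

  affine-Step : ∀ f b d {c x y} → Step c x y → Step c (affine f b d x) (affine f b d y)
  affine-Step f b d {c} {x} {y} (l , r) =
    trans (cong (b xor_) l) (sym (not-distribʳ-xor b (layer x))) ,
    ±-Related-resp (idx-affine f b d x) (idx-affine f b d y) (affine-±-Related f d r)

  affine-preserves-Outer : ∀ f b c → affine f b c Preserves Outer n ⟶ Outer n
  affine-preserves-Outer f b c {x} {y} o with Outer⇒ o
  ... | sx , sy , st = ⇒Outer {affine f b c x} {affine f b c y} sx sy (affine-Step f b c {1ℤ} {x} {y} st)

  affine-preserves-Inner : ∀ f b c → affine f b c Preserves Inner n k ⟶ Inner n k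
  affine-preserves-Inner f b c {x} {y} i with Inner⇒ i
  ... | sx , sy , st = ⇒Inner {k} {affine f b c x} {affine f b c y} sx sy (affine-Step f b c {+ k} {x} {y} st)

  affine-preserves-Spoke : ∀ f b c → affine f b c Preserves Spoke n ⟶ Spoke n
  affine-preserves-Spoke f b c {x} {y} s with Spoke⇒ s
  ... | sy , l , e = ⇒Spoke {affine f b c x} {affine f b c y} sy
    (trans (cong (b xor_) l) (sym (not-distribʳ-xor b (layer x))))
    (mod-trans (idx-affine f b c y) (mod-trans (+-mod-cong (*-mod-congˡ (±1 f) e) mod-refl) (mod-sym (idx-affine f b c x))))

  affine-∘ : ∀ f b c f′ b′ c′ x →
             affine f′ b′ c′ (affine f b c x) ≡ affine (f xor f′) (b xor b′) (±1 f′ * c + c′) x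
  affine-∘ f b c f′ b′ c′ x = vertex-≡ refl idx-≡ layer-≡
    where
    open import Relation.Binary.Reasoning.Setoid (mod-setoid {N})
    regroup : ∀ s t a c d → t * (s * a + c) + d ≡ (s * t) * a + (t * c + d)
    regroup = solve-∀
    idx-≡ : idx (affine f′ b′ c′ (affine f b c x))
          ≡ idx (affine (f xor f′) (b xor b′) (±1 f′ * c + c′) x) mod N
    idx-≡ = begin
      idx (affine f′ b′ c′ (affine f b c x))    ≈⟨ idx-affine f′ b′ c′ (affine f b c x) ⟩
      ±1 f′ * idx (affine f b c x) + c′         ≈⟨ +-mod-cong (*-mod-congˡ (±1 f′) (idx-affine f b c x)) mod-refl ⟩
      ±1 f′ * (±1 f * idx x + c) + c′           ≡⟨ regroup (±1 f) (±1 f′) (idx x) c c′ ⟩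
      (±1 f * ±1 f′) * idx x + (±1 f′ * c + c′) ≡⟨ cong (λ s → s * idx x + (±1 f′ * c + c′)) (±1-xor f f′) ⟨
      ±1 (f xor f′) * idx x + (±1 f′ * c + c′)  ≈⟨ idx-affine (f xor f′) (b xor b′) _ x ⟨
      idx (affine (f xor f′) (b xor b′) (±1 f′ * c + c′) x) ∎
    layer-≡ : b′ xor (b xor layer x) ≡ (b xor b′) xor layer x
    layer-≡ = trans (sym (xor-assoc b′ b (layer x))) (cong (_xor layer x) (xor-comm b′ b))

  affine-identity : ∀ x → affine false false 0ℤ x ≡ x
  affine-identity x = vertex-≡ refl (mod-trans (idx-affine false false 0ℤ x) (mod-reflexive (unit (idx x)))) refl
    where
    unit : ∀ a → 1ℤ * a + 0ℤ ≡ a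
    unit = solve-∀

  affine-≡ : ∀ {f f′ b b′ c c′} x → f ≡ f′ → b ≡ b′ → c ≡ c′ mod N → affine f b c x ≡ affine f′ b′ c′ x
  affine-≡ {f} {b = b} x refl refl e = affine-mod-cong f b x e

  affine-inverseˡ : ∀ f b c x → affine f b (- (±1 f * c)) (affine f b c x) ≡ x
  affine-inverseˡ f b c x = begin
    affine f b (- (±1 f * c)) (affine f b c x)        ≡⟨ affine-∘ f b c f b (- (±1 f * c)) x ⟩
    affine (f xor f) (b xor b) (±1 f * c - ±1 f * c) x ≡⟨ affine-≡ x (xor-same f) (xor-same b)
                                                          (mod-reflexive (ℤ.+-inverseʳ (±1 f * c))) ⟩
    affine false false 0ℤ x                           ≡⟨ affine-identity x ⟩
    x                                                 ∎
    where open ≡-Reasoning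

  affine-inverseʳ : ∀ f b c x → affine f b c (affine f b (- (±1 f * c)) x) ≡ x
  affine-inverseʳ f b c x = begin
    affine f b c (affine f b (- (±1 f * c)) x)          ≡⟨ affine-∘ f b (- (±1 f * c)) f b c x ⟩
    affine (f xor f) (b xor b) (±1 f * - (±1 f * c) + c) x ≡⟨ affine-≡ x (xor-same f) (xor-same b)
                                                             (mod-reflexive cancel) ⟩
    affine false false 0ℤ x                             ≡⟨ affine-identity x ⟩
    x                                                   ∎
    where
    open ≡-Reasoning
    regroup : ∀ s c → s * - (s * c) + c ≡ (1ℤ - s * s) * c
    regroup = solve-∀
    cancel : ±1 f * - (±1 f * c) + c ≡ 0ℤ
    cancel = trans (regroup (±1 f) c) (trans (cong (λ s → (1ℤ - s) * c) (±1-square f)) (ℤ.*-zeroˡ c))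

  affinePerm : Bool → Bool → ℤ → Perm Vx
  affinePerm f b c = record
    { to = affine f b c ; from = affine f b (- (±1 f * c))
    ; from∘to = affine-inverseˡ f b c ; to∘from = affine-inverseʳ f b c }

  affine∈C : ∀ f b c → C n k (affinePerm f b c)
  affine∈C f b c =
    stabilises (λ f b c → preserves-Adj {affine f b c} (affine-preserves-Outer f b c) (affine-preserves-Inner f b c)
                                        (affine-preserves-Spoke f b c)) ,
    stabilises affine-preserves-Outer , stabilises affine-preserves-Inner , stabilises affine-preserves-Spoke
    where
    stabilises : ∀ {R} → (∀ f b c → affine f b c Preserves R ⟶ R) → Stabilises R (affinePerm f b c)
    stabilises {R} p = preserves⇒stabilises {R = R} (affinePerm f b c) (p f b c) (p f b _)

  affine-factorisation : ∀ f b c x →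
    affine f b c x ≡ affine false false (iℤ (toFin c)) (affine false b 0ℤ (affine f false 0ℤ x))
  affine-factorisation f b c x = sym (begin
    affine false false (iℤ (toFin c)) (affine false b 0ℤ (affine f false 0ℤ x))
      ≡⟨ cong (affine false false (iℤ (toFin c))) (affine-∘ f false 0ℤ false b 0ℤ x) ⟩
    affine false false (iℤ (toFin c)) (affine (f xor false) b (1ℤ * 0ℤ + 0ℤ) x)
      ≡⟨ affine-∘ (f xor false) b _ false false (iℤ (toFin c)) x ⟩
    affine ((f xor false) xor false) (b xor false) (1ℤ * (1ℤ * 0ℤ + 0ℤ) + iℤ (toFin c)) x
      ≡⟨ affine-≡ x (trans (xor-identityʳ _) (xor-identityʳ f)) (xor-identityʳ b)
                    (mod-trans (mod-reflexive (zeros (iℤ (toFin c)))) (toFin-mod c)) ⟩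
    affine f b c x ∎)
    where
    open ≡-Reasoning
    zeros : ∀ t → 1ℤ * (1ℤ * 0ℤ + 0ℤ) + t ≡ t
    zeros = solve-∀

  ρ-affine : ∀ x → affine false false 1ℤ x ≡ ρ-map n x
  ρ-affine (s , i , j) = vtx-mod-cong s j (mod-reflexive (cong (_+ 1ℤ) (ℤ.*-identityˡ (iℤ i))))

  δ-affine : ∀ x → affine true false 0ℤ x ≡ δ-map n x
  δ-affine (s , i , j) = vtx-mod-cong s j (mod-reflexive (negate (iℤ i)))
    where
    negate : ∀ a → -1ℤ * a + 0ℤ ≡ - a
    negate = solve-∀

  β-affine : ∀ x → affine false true 0ℤ x ≡ β-map n x
  β-affine x@(s , i , j) = vertex-≡ refl (mod-trans (idx-affine false true 0ℤ x) (mod-reflexive (unit (iℤ i)))) refl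
    where
    unit : ∀ a → 1ℤ * a + 0ℤ ≡ a
    unit = solve-∀

  module _ (g : Vx → Vx) where

    ρ-power∈⟨ρδβ⟩ : ∀ t → ⟨ RDB+ n g ⟩ (affinePerm false false (+ t))
    ρ-power∈⟨ρδβ⟩ ℕ.zero    = ext one (λ x → sym (affine-identity x))
    ρ-power∈⟨ρδβ⟩ (ℕ.suc t) = ext (mul (ρ-power∈⟨ρδβ⟩ t) (gen {σ = affinePerm false false 1ℤ} (inj₁ ρ-affine))) λ x →
      trans (affine-∘ false false (+ t) false false 1ℤ x) (affine-mod-cong false false x (mod-reflexive
        (trans (cong (_+ 1ℤ) (ℤ.*-identityˡ (+ t))) (cong +_ (ℕ.+-comm t 1)))))

    affine∈⟨ρδβ⟩ : ∀ f b c → ⟨ RDB+ n g ⟩ (affinePerm f b c)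
    affine∈⟨ρδβ⟩ f b c =
      ext (mul (mul (δ-power f) (β-power b)) (ρ-power∈⟨ρδβ⟩ (toℕ (toFin c)))) (λ x → sym (affine-factorisation f b c x))
      where
      δ-power : ∀ f → ⟨ RDB+ n g ⟩ (affinePerm f false 0ℤ)
      δ-power false = ext one (λ x → sym (affine-identity x))
      δ-power true  = gen (inj₂ (inj₁ δ-affine))
      β-power : ∀ b → ⟨ RDB+ n g ⟩ (affinePerm false b 0ℤ)
      β-power false = ext one (λ x → sym (affine-identity x))
      β-power true  = gen (inj₂ (inj₂ (inj₁ β-affine)))

  IsAffine : (Vx → Vx) → Set
  IsAffine f = Σ Bool λ fl → Σ Bool λ b → Σ ℤ λ c → ∀ x → f x ≡ affine fl b c x

  affine-injective : ∀ fl b c {x y} → affine fl b c x ≡ affine fl b c y → x ≡ y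
  affine-injective fl b c {x} {y} e =
    trans (sym (affine-inverseˡ fl b c x)) (trans (cong (affine fl b _) e) (affine-inverseˡ fl b c y))

module Parity (m k h : ℕ) (n≡2h : ℕ.suc m ≡ 2 ℕ.* h) (k-even : + k ≡ 0ℤ mod + 2) where

  open import Data.Fin using (Fin; toℕ)
  open import Data.Bool.Properties using (not-involutive; not-injective)
  open import Data.Integer hiding (suc; _≤_; _<_)
  import Data.Integer.Properties as ℤ
  open import Data.Integer.Tactic.RingSolver using (solve-∀)
  open Congruence
  open Signs
  open Sides

  oddSum≡isOdd : ∀ {n} (i : Fin n) j → oddSum i j ≡ isOdd (iℤ i + + bit j)
  oddSum≡isOdd i false with (toℕ i ℕ.+ 0) ℕ.% 2
  ... | ℕ.zero  = refl
  ... | ℕ.suc _ = refl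
  oddSum≡isOdd i true with (toℕ i ℕ.+ 1) ℕ.% 2
  ... | ℕ.zero  = refl
  ... | ℕ.suc _ = refl

  open AffineMaps m k public

  H : ℤ
  H = + h

  K : ℤ
  K = + k

  N≡2H : N ≡ + 2 * H
  N≡2H = trans (cong +_ n≡2h) (ℤ.pos-* 2 h)

  mod-N⇒mod-2 : ∀ {a b} → a ≡ b mod N → a ≡ b mod + 2
  mod-N⇒mod-2 {a} {b} c = mod-weaken {E = H} (subst (λ D → a ≡ b mod D) N≡2H c)

  parity : Vx → Bool
  parity x = isOdd (idx x + + bit (layer x))

  ±-Related⇒mod2 : ∀ {c a b} → ±-Related c a b → b ≡ a + c mod + 2
  ±-Related⇒mod2 (plus r)  = mod-N⇒mod-2 r
  ±-Related⇒mod2 {c} {a} (minus r) = mod-trans (mod-N⇒mod-2 r) (+-mod-cong (mod-refl {a = a}) (- c , neg≡ c))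
    where
    neg≡ : ∀ c → - c ≡ c + - c * + 2
    neg≡ = solve-∀

  Step-mod2 : ∀ {c x y} → Step c x y → idx y + + bit (layer y) ≡ (idx x + + bit (layer x)) + (c + 1ℤ) mod + 2
  Step-mod2 {c} {x} {y} (l , r) = mod-trans
    (+-mod-cong (±-Related⇒mod2 r)
      (subst (λ j → + bit j ≡ + bit (layer x) + 1ℤ mod + 2) (sym l) (bit-not-mod2 (layer x))))
    (mod-reflexive (regroup (idx x) (+ bit (layer x)) c))
    where
    regroup : ∀ a b c → (a + c) + (b + 1ℤ) ≡ (a + b) + (c + 1ℤ)
    regroup = solve-∀

  Step-odd⇒parity-≡ : ∀ {c x y} → Step c x y → c ≡ 1ℤ mod + 2 → parity y ≡ parity x
  Step-odd⇒parity-≡ {c} {x} {y} st c≡1 = isOdd-+-even (idx x + + bit (layer x)) (Step-mod2 {c} {x} {y} st)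
    (mod-trans (+-mod-cong c≡1 (mod-refl {a = 1ℤ})) (1ℤ , refl))

  Step-even⇒parity-not : ∀ {c x y} → Step c x y → c ≡ 0ℤ mod + 2 → parity y ≡ not (parity x)
  Step-even⇒parity-not {c} {x} {y} st c≡0 = isOdd-+-odd (idx x + + bit (layer x)) (Step-mod2 {c} {x} {y} st)
    (+-mod-cong c≡0 (mod-refl {a = 1ℤ}))

  Outer-parity : ∀ {x y} → Step 1ℤ x y → parity y ≡ parity x
  Outer-parity {x} {y} st = Step-odd⇒parity-≡ {1ℤ} {x} {y} st mod-refl

  Inner-parity : ∀ {x y} → Step K x y → parity y ≡ not (parity x)
  Inner-parity {x} {y} st = Step-even⇒parity-not {K} {x} {y} st k-even

  Spoke-parity : ∀ {x y} → layer y ≡ not (layer x) → idx y ≡ idx x mod N → parity y ≡ not (parity x)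
  Spoke-parity {x} {y} l e =
    Step-even⇒parity-not {0ℤ} {x} {y} (l , plus (mod-trans e (mod-reflexive (sym (ℤ.+-identityʳ (idx x)))))) mod-refl

  ±1-odd : ∀ f → ±1 f ≡ 1ℤ mod + 2
  ±1-odd false = mod-refl
  ±1-odd true  = -1ℤ , refl

  ±-Related-±1 : ∀ f {a b} → ±-Related (±1 f) a b → ±-Related 1ℤ a b
  ±-Related-±1 false r         = r
  ±-Related-±1 true  (plus r)  = minus r
  ±-Related-±1 true  (minus r) = plus r

  -- Whether λ/τ uses the index formula e + (i − k)k (rather than ik) at a vertex of this side
  -- whose index plus layer has the given parity.
  branch : Side → Bool → Bool
  branch U p = p
  branch V p = not p

  branch-opp-not : ∀ s p → branch (opp s) (not p) ≡ branch s p
  branch-opp-not U p = not-involutive p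
  branch-opp-not V p = refl

  branch-injective : ∀ s {p q} → branch s p ≡ branch s q → p ≡ q
  branch-injective U e = e
  branch-injective V e = not-injective e

  module TwistMap (f : Bool) (k²≡e : K * K ≡ ±1 f mod H) where

    e : ℤ
    e = ±1 f

    2k²≡2e : + 2 * (K * K) ≡ + 2 * e mod N
    2k²≡2e = subst (λ D → + 2 * (K * K) ≡ + 2 * e mod D) (sym N≡2H)
      (mod-trans (mod-reflexive (ℤ.*-comm (+ 2) (K * K)))
                 (mod-trans (mod-double k²≡e) (mod-reflexive (ℤ.*-comm e (+ 2)))))

    twistIdx : Bool → ℤ → ℤ
    twistIdx true  a = e + (a - K) * K
    twistIdx false a = a * K

    twistIdx-mod-cong : ∀ t {a a′} → a ≡ a′ mod N → twistIdx t a ≡ twistIdx t a′ mod N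
    twistIdx-mod-cong true  c = +-mod-cong (mod-refl {a = e}) (*-mod-congʳ K (+-mod-cong c (mod-refl {a = - K})))
    twistIdx-mod-cong false c = *-mod-congʳ K c

    twistIdx-+1 : ∀ t a → twistIdx t (a + 1ℤ) ≡ twistIdx t a + K
    twistIdx-+1 true  a = shifted e a K
      where
      shifted : ∀ e a K → e + (a + 1ℤ - K) * K ≡ e + (a - K) * K + K
      shifted = solve-∀
    twistIdx-+1 false a = shifted a K
      where
      shifted : ∀ a K → (a + 1ℤ) * K ≡ a * K + K
      shifted = solve-∀

    twistIdx--1 : ∀ t a → twistIdx t (a - 1ℤ) ≡ twistIdx t a - K
    twistIdx--1 true  a = shifted e a K
      where
      shifted : ∀ e a K → e + (a - 1ℤ - K) * K ≡ e + (a - K) * K - K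
      shifted = solve-∀
    twistIdx--1 false a = shifted a K
      where
      shifted : ∀ a K → (a - 1ℤ) * K ≡ a * K - K
      shifted = solve-∀

    twistIdx-outer : ∀ t {a a′} → ±-Related 1ℤ a a′ → ±-Related K (twistIdx t a) (twistIdx t a′)
    twistIdx-outer t {a} (plus r)  = plus (mod-trans (twistIdx-mod-cong t r) (mod-reflexive (twistIdx-+1 t a)))
    twistIdx-outer t {a} (minus r) = minus (mod-trans (twistIdx-mod-cong t r) (mod-reflexive (twistIdx--1 t a)))

    twistIdx-inner : ∀ t {a a′} → ±-Related K a a′ → ±-Related e (twistIdx t a) (twistIdx (not t) a′)
    twistIdx-inner true {a} {a′} (plus r) = plus (begin
      a′ * K                                  ≈⟨ *-mod-congʳ K r ⟩
      (a + K) * K                             ≡⟨ split e a K ⟩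
      (e + (a - K) * K) + (+ 2 * (K * K) - e) ≈⟨ +-mod-cong (mod-refl {a = e + (a - K) * K}) (+-mod-cong 2k²≡2e mod-refl) ⟩
      (e + (a - K) * K) + (+ 2 * e - e)       ≡⟨ cong (λ z → e + (a - K) * K + z) (twice-minus e) ⟩
      e + (a - K) * K + e                     ∎)
      where
      open import Relation.Binary.Reasoning.Setoid (mod-setoid {N})
      split : ∀ e a K → (a + K) * K ≡ (e + (a - K) * K) + (+ 2 * (K * K) - e)
      split = solve-∀
      twice-minus : ∀ e → + 2 * e - e ≡ e
      twice-minus = solve-∀
    twistIdx-inner true {a} (minus r) = minus (mod-trans (*-mod-congʳ K r) (mod-reflexive (split e a K)))
      where
      split : ∀ e a K → (a - K) * K ≡ e + (a - K) * K - e
      split = solve-∀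
    twistIdx-inner false {a} (plus r) =
      plus (mod-trans (+-mod-cong (mod-refl {a = e}) (*-mod-congʳ K (+-mod-cong r mod-refl))) (mod-reflexive (split e a K)))
      where
      split : ∀ e a K → e + (a + K - K) * K ≡ a * K + e
      split = solve-∀
    twistIdx-inner false {a} {a′} (minus r) = minus (begin
      e + (a′ - K) * K               ≈⟨ +-mod-cong (mod-refl {a = e}) (*-mod-congʳ K (+-mod-cong r mod-refl)) ⟩
      e + (a - K - K) * K            ≡⟨ split e a K ⟩
      a * K + (e - + 2 * (K * K))    ≈⟨ +-mod-cong (mod-refl {a = a * K}) (+-mod-cong (mod-refl {a = e}) (neg-mod-cong 2k²≡2e)) ⟩
      a * K + (e - + 2 * e)          ≡⟨ cong (λ z → a * K + z) (minus-twice e) ⟩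
      a * K - e                      ∎)
      where
      open import Relation.Binary.Reasoning.Setoid (mod-setoid {N})
      split : ∀ e a K → e + (a - K - K) * K ≡ a * K + (e - + 2 * (K * K))
      split = solve-∀
      minus-twice : ∀ e → e - + 2 * e ≡ - e
      minus-twice = solve-∀

    twistIdx-mod2 : ∀ t a → twistIdx t a ≡ + bit t mod + 2
    twistIdx-mod2 true  a =
      +-mod-cong (±1-odd f) (mod-trans (*-mod-congˡ (a - K) k-even) (mod-reflexive (ℤ.*-zeroʳ (a - K))))
    twistIdx-mod2 false a = mod-trans (*-mod-congˡ a k-even) (mod-reflexive (ℤ.*-zeroʳ a))

    twistIdx-injective : ∀ {t t′ a a′} → twistIdx t a ≡ twistIdx t′ a′ mod N → t ≡ t′
    twistIdx-injective {t} {t′} {a} {a′} c = trans (isOdd-bit t) (trans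
      (isOdd-mod-cong (mod-trans (mod-sym (twistIdx-mod2 t a)) (mod-trans (mod-N⇒mod-2 c) (twistIdx-mod2 t′ a′))))
      (sym (isOdd-bit t′)))
      where
      isOdd-bit : ∀ t → t ≡ isOdd (+ bit t)
      isOdd-bit false = refl
      isOdd-bit true  = refl

    twistIdx-cancel : ∀ t {a a′} → twistIdx t a ≡ twistIdx t a′ mod N → a ≡ a′ mod + 2 → a ≡ a′ mod N
    twistIdx-cancel t {a} {a′} c c₂ = m-n≡0⇒m≡n-mod (subst (λ D → a - a′ ≡ 0ℤ mod D) (sym N≡2H)
      (even-unit-cancel k²≡e (±1-square f) (subst (λ D → (a - a′) * K ≡ 0ℤ mod D) N≡2H diff≡0) (m≡n⇒m-n≡0-mod c₂)))
      where
      difference : ∀ t → twistIdx t a - twistIdx t a′ ≡ (a - a′) * K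
      difference true  = lemma e a a′ K
        where
        lemma : ∀ e a a′ K → e + (a - K) * K - (e + (a′ - K) * K) ≡ (a - a′) * K
        lemma = solve-∀
      difference false = lemma a a′ K
        where
        lemma : ∀ a a′ K → a * K - a′ * K ≡ (a - a′) * K
        lemma = solve-∀
      diff≡0 : (a - a′) * K ≡ 0ℤ mod N
      diff≡0 = mod-trans (mod-reflexive (sym (difference t))) (m≡n⇒m-n≡0-mod c)

    tw : Vx → Vx
    tw = twist n k e

    tw-coordinates : ∀ x → tw x ≡ (opp (side x) , toFin (twistIdx (branch (side x) (parity x)) (idx x)) , layer x)
    tw-coordinates (U , i , j) rewrite oddSum≡isOdd i j with isOdd (iℤ i + + bit j)
    ... | true  = refl
    ... | false = refl
    tw-coordinates (V , i , j) rewrite oddSum≡isOdd i j with isOdd (iℤ i + + bit j)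
    ... | true  = refl
    ... | false = refl

    side-tw : ∀ x → side (tw x) ≡ opp (side x)
    side-tw x = cong side (tw-coordinates x)

    layer-tw : ∀ x → layer (tw x) ≡ layer x
    layer-tw x = cong layer (tw-coordinates x)

    idx-tw : ∀ x {t} → branch (side x) (parity x) ≡ t → idx (tw x) ≡ twistIdx t (idx x) mod N
    idx-tw x refl = subst (λ v → idx v ≡ twistIdx (branch (side x) (parity x)) (idx x) mod N)
                          (sym (tw-coordinates x)) (toFin-mod _)

    layer-tw-flip : ∀ {x y} → layer y ≡ not (layer x) → layer (tw y) ≡ not (layer (tw x))
    layer-tw-flip {x} {y} l = trans (layer-tw y) (trans l (cong not (sym (layer-tw x))))

    tw-Outer⇒Inner : ∀ {x y} → Outer n x y → Inner n k (tw x) (tw y)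
    tw-Outer⇒Inner {x} {y} o with Outer⇒ o
    ... | refl , sy , st@(l , r) = ⇒Inner {k} {tw x} {tw y} (side-tw x) (trans (side-tw y) (cong opp sy))
      (layer-tw-flip {x} {y} l , ±-Related-resp (idx-tw x refl) (idx-tw y (cong₂ branch sy (Outer-parity {x} {y} st)))
                                   (twistIdx-outer (parity x) r))

    tw-Inner⇒Outer : ∀ {x y} → Inner n k x y → Outer n (tw x) (tw y)
    tw-Inner⇒Outer {x} {y} i with Inner⇒ i
    ... | refl , sy , st@(l , r) = ⇒Outer {tw x} {tw y} (side-tw x) (trans (side-tw y) (cong opp sy))
      (layer-tw-flip {x} {y} l , ±-Related-±1 f (±-Related-resp (idx-tw x refl)
        (idx-tw y (cong₂ branch sy (Inner-parity {x} {y} st))) (twistIdx-inner (not (parity x)) r)))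

    tw-Spoke⇒Spoke : ∀ {x y} → Spoke n x y → Spoke n (tw x) (tw y)
    tw-Spoke⇒Spoke {x} {y} s with Spoke⇒ s
    ... | sy , l , c = ⇒Spoke {tw x} {tw y} (trans (side-tw y) (trans (cong opp sy) (sym (cong opp (side-tw x)))))
      (layer-tw-flip {x} {y} l)
      (mod-trans (idx-tw y same-branch)
        (mod-trans (twistIdx-mod-cong (branch (side x) (parity x)) c) (mod-sym (idx-tw x refl))))
      where
      same-branch : branch (side y) (parity y) ≡ branch (side x) (parity x)
      same-branch = trans (cong₂ branch sy (Spoke-parity {x} {y} l c)) (branch-opp-not (side x) (parity x))

    tw-injective : ∀ {x y} → tw x ≡ tw y → x ≡ y
    tw-injective {x} {y} eq = vertex-≡ same-side (twistIdx-cancel ty idx≡ idx≡₂) same-layer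
      where
      tx = branch (side x) (parity x)
      ty = branch (side y) (parity y)
      eq′ : (opp (side x) , toFin (twistIdx tx (idx x)) , layer x) ≡ (opp (side y) , toFin (twistIdx ty (idx y)) , layer y)
      eq′ = trans (sym (tw-coordinates x)) (trans eq (tw-coordinates y))
      same-side : side x ≡ side y
      same-side = opp-injective (cong side eq′)
      same-layer : layer x ≡ layer y
      same-layer = cong layer eq′
      idx≡′ : twistIdx tx (idx x) ≡ twistIdx ty (idx y) mod N
      idx≡′ = toFin-injective-mod (cong (λ v → proj₁ (proj₂ v)) eq′)
      same-branch : tx ≡ ty
      same-branch = twistIdx-injective idx≡′
      idx≡ : twistIdx ty (idx x) ≡ twistIdx ty (idx y) mod N
      idx≡ = subst (λ t → twistIdx t (idx x) ≡ twistIdx ty (idx y) mod N) same-branch idx≡′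
      same-parity : parity x ≡ parity y
      same-parity = branch-injective (side x) (trans same-branch (cong (λ s → branch s (parity y)) (sym same-side)))
      idx≡₂ : idx x ≡ idx y mod + 2
      idx≡₂ = +-mod-cancelʳ (+ bit (layer x))
        (subst (λ j → idx x + + bit (layer x) ≡ idx y + + bit j mod + 2) (sym same-layer)
               (isOdd-injective-mod2 same-parity))

module VertexFamilies (m k h : ℕ) (n≡2h : ℕ.suc m ≡ 2 ℕ.* h) (k-even : + k ≡ 0ℤ mod + 2) where

  open import Data.Fin using (toℕ)
  open import Data.Bool.Properties using (not-involutive; xor-same; xor-inverseʳ)
  import Data.Sum
  open import Data.Integer hiding (suc; _≤_; _<_)
  import Data.Integer.Properties as ℤ
  open import Data.Integer.Tactic.RingSolver using (solve-∀)
  open Congruence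
  open Signs
  open Sides

  open Parity m k h n≡2h k-even public

  -- The superscript is the parity of index plus layer.
  uᵉ uᵒ vᵉ vᵒ : ℤ → Vx
  uᵉ t = vtx U t (isOdd t)
  uᵒ t = vtx U t (not (isOdd t))
  vᵉ t = vtx V t (isOdd t)
  vᵒ t = vtx V t (not (isOdd t))

  families-cover : ∀ (P : Vx → Set) → (∀ t → P (uᵉ t)) → (∀ t → P (uᵒ t)) →
                   (∀ t → P (vᵉ t)) → (∀ t → P (vᵒ t)) → ∀ x → P x
  families-cover P pᵘᵉ pᵘᵒ pᵛᵉ pᵛᵒ x@(U , i , j) with bool-dichotomy (isOdd (iℤ i)) j
  ... | inj₁ j≡ = subst P (trans (cong (vtx U (iℤ i)) (sym j≡)) (vtx-η x)) (pᵘᵉ (iℤ i))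
  ... | inj₂ j≡ = subst P (trans (cong (vtx U (iℤ i)) (sym j≡)) (vtx-η x)) (pᵘᵒ (iℤ i))
  families-cover P pᵘᵉ pᵘᵒ pᵛᵉ pᵛᵒ x@(V , i , j) with bool-dichotomy (isOdd (iℤ i)) j
  ... | inj₁ j≡ = subst P (trans (cong (vtx V (iℤ i)) (sym j≡)) (vtx-η x)) (pᵛᵉ (iℤ i))
  ... | inj₂ j≡ = subst P (trans (cong (vtx V (iℤ i)) (sym j≡)) (vtx-η x)) (pᵛᵒ (iℤ i))

  isOdd-+1 : ∀ t → isOdd (t + 1ℤ) ≡ not (isOdd t)
  isOdd-+1 t = isOdd-+-odd t mod-refl mod-refl

  isOdd--1 : ∀ t → isOdd (t - 1ℤ) ≡ not (isOdd t)
  isOdd--1 t = isOdd-+-odd t mod-refl (-1ℤ , refl)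

  isOdd-+K : ∀ t → isOdd (t + K) ≡ isOdd t
  isOdd-+K t = isOdd-+-even t mod-refl k-even

  isOdd--K : ∀ t → isOdd (t - K) ≡ isOdd t
  isOdd--K t = isOdd-+-even t mod-refl (neg-mod-cong k-even)

  family-mod-cong : ∀ s (p : Bool → Bool) {a b} → a ≡ b mod N → vtx s a (p (isOdd a)) ≡ vtx s b (p (isOdd b))
  family-mod-cong s p {a} c = trans (cong (vtx s a ∘ p) (isOdd-mod-cong (mod-N⇒mod-2 c))) (vtx-mod-cong s _ c)

  vtx-≢ : ∀ {s a b j j′} → ¬ a ≡ b mod N → ¬ vtx s a j ≡ vtx s b j′
  vtx-≢ a≢b e = a≢b (idx-vtx-injective e)

  uᵉ-outer : ∀ t → Outer n (uᵉ t) (uᵉ (t + 1ℤ))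
  uᵉ-outer t = ⇒Outer {uᵉ t} {uᵉ (t + 1ℤ)} refl refl
    (isOdd-+1 t , plus (mod-trans (idx-vtx U (t + 1ℤ) (isOdd (t + 1ℤ)))
                                  (+-mod-cong (mod-sym (idx-vtx U t (isOdd t))) mod-refl)))

  uᵒ-outer : ∀ t → Outer n (uᵒ t) (uᵒ (t + 1ℤ))
  uᵒ-outer t = ⇒Outer {uᵒ t} {uᵒ (t + 1ℤ)} refl refl
    (cong not (isOdd-+1 t) , plus (mod-trans (idx-vtx U (t + 1ℤ) (not (isOdd (t + 1ℤ))))
                                             (+-mod-cong (mod-sym (idx-vtx U t (not (isOdd t)))) mod-refl)))

  uᵉ-spoke : ∀ t → Spoke n (uᵉ t) (vᵒ t)
  uᵉ-spoke t = ⇒Spoke {uᵉ t} {vᵒ t} refl refl (mod-trans (idx-vtx V t (not (isOdd t))) (mod-sym (idx-vtx U t (isOdd t))))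

  vᵉ-spoke : ∀ t → Spoke n (vᵉ t) (uᵒ t)
  vᵉ-spoke t = ⇒Spoke {vᵉ t} {uᵒ t} refl refl (mod-trans (idx-vtx U t (not (isOdd t))) (mod-sym (idx-vtx V t (isOdd t))))

  vᵉ-inner⁺ : ∀ t → Inner n k (vᵉ t) (vᵒ (t + K))
  vᵉ-inner⁺ t = ⇒Inner {k} {vᵉ t} {vᵒ (t + K)} refl refl
    (cong not (isOdd-+K t) , plus (mod-trans (idx-vtx V (t + K) (not (isOdd (t + K))))
                                             (+-mod-cong (mod-sym (idx-vtx V t (isOdd t))) mod-refl)))

  vᵉ-inner⁻ : ∀ t → Inner n k (vᵉ t) (vᵒ (t - K))
  vᵉ-inner⁻ t = ⇒Inner {k} {vᵉ t} {vᵒ (t - K)} refl refl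
    (cong not (isOdd--K t) , minus (mod-trans (idx-vtx V (t - K) (not (isOdd (t - K))))
                                              (+-mod-cong (mod-sym (idx-vtx V t (isOdd t))) mod-refl)))

  outer-neighbour-uᵉ : ∀ {a z} → Outer n (uᵉ a) z → z ≡ uᵉ (a + 1ℤ) ⊎ z ≡ uᵉ (a - 1ℤ)
  outer-neighbour-uᵉ {a} o with Outer⇒ o
  ... | _ , sz , l , plus r  = inj₁ (≡-vtx U (a + 1ℤ) _ sz (mod-trans r (+-mod-cong (idx-vtx U a (isOdd a)) mod-refl))
                                           (trans l (sym (isOdd-+1 a))))
  ... | _ , sz , l , minus r = inj₂ (≡-vtx U (a - 1ℤ) _ sz (mod-trans r (+-mod-cong (idx-vtx U a (isOdd a)) mod-refl))
                                           (trans l (sym (isOdd--1 a))))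

  inner-neighbour-vᵒ : ∀ {a z} → Inner n k (vᵒ a) z → z ≡ vᵉ (a + K) ⊎ z ≡ vᵉ (a - K)
  inner-neighbour-vᵒ {a} i with Inner⇒ i
  ... | _ , sz , l , plus r  = inj₁ (≡-vtx V (a + K) _ sz (mod-trans r (+-mod-cong (idx-vtx V a (not (isOdd a))) mod-refl))
                                           (trans l (trans (not-involutive _) (sym (isOdd-+K a)))))
  ... | _ , sz , l , minus r = inj₂ (≡-vtx V (a - K) _ sz (mod-trans r (+-mod-cong (idx-vtx V a (not (isOdd a))) mod-refl))
                                           (trans l (trans (not-involutive _) (sym (isOdd--K a)))))

  spoke-partner-uᵉ : ∀ {a z} → Spoke n (uᵉ a) z → z ≡ vᵒ a
  spoke-partner-uᵉ {a} s with Spoke⇒ s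
  ... | sz , l , c = ≡-vtx V a _ sz (mod-trans c (idx-vtx U a (isOdd a))) l

  spoke-partner-vᵉ : ∀ {a z} → Spoke n (vᵉ a) z → z ≡ uᵒ a
  spoke-partner-vᵉ {a} s with Spoke⇒ s
  ... | sz , l , c = ≡-vtx U a _ sz (mod-trans c (idx-vtx V a (isOdd a))) l

  Outer-sym : ∀ {x y} → Outer n x y → Outer n y x
  Outer-sym = Data.Sum.swap

  Inner-sym : ∀ {x y} → Inner n k x y → Inner n k y x
  Inner-sym = Data.Sum.swap

  +-sub : ∀ t K → t + K - K ≡ t
  +-sub = solve-∀

  -+-sub : ∀ t K → t - K + K ≡ t
  -+-sub = solve-∀

  +-≢ : ∀ {d} → ¬ d ≡ 0ℤ mod N → ∀ a {b} → b ≡ a + d mod N → ¬ a ≡ b mod N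
  +-≢ {d} d≢0 a {b} b≡a+d a≡b = d≢0 (+-mod-cancelʳ a (begin
    d + a   ≡⟨ ℤ.+-comm d a ⟩
    a + d   ≈⟨ b≡a+d ⟨
    b       ≈⟨ a≡b ⟨
    a       ≡⟨ ℤ.+-identityˡ a ⟨
    0ℤ + a  ∎))
    where open import Relation.Binary.Reasoning.Setoid (mod-setoid {N})

  module Rigidity (2≢0 : ¬ + 2 ≡ 0ℤ mod N) (4k≢0 : ¬ + 4 * K ≡ 0ℤ mod N)
    {g : Vx → Vx} (g-injective : ∀ {x y} → g x ≡ g y → x ≡ y)
    (g-outer : g Preserves Outer n ⟶ Outer n) (g-inner : g Preserves Inner n k ⟶ Inner n k)
    (g-spoke : g Preserves Spoke n ⟶ Spoke n)
    (g-uᵉ₀ : g (uᵉ 0ℤ) ≡ uᵉ 0ℤ) (g-uᵉ₁ : g (uᵉ 1ℤ) ≡ uᵉ 1ℤ) where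

    Fixed : Vx → Set
    Fixed v = g v ≡ v

    fixes-uᵉ-next : ∀ t → Fixed (uᵉ t) → Fixed (uᵉ (t + 1ℤ)) → Fixed (uᵉ (t + 1ℤ + 1ℤ))
    fixes-uᵉ-next t fix₀ fix₁
      with outer-neighbour-uᵉ {t + 1ℤ} (subst (λ v → Outer n v (g (uᵉ (t + 1ℤ + 1ℤ)))) fix₁ (g-outer (uᵉ-outer (t + 1ℤ))))
    ... | inj₁ e = e
    ... | inj₂ e = ⊥-elim (vtx-≢ (+-≢ 2≢0 t two-apart) (sym (g-injective (trans e (trans back (sym fix₀))))))
      where
      back : uᵉ (t + 1ℤ - 1ℤ) ≡ uᵉ t
      back = family-mod-cong U (λ p → p) (mod-reflexive (cancel t))
        where
        cancel : ∀ t → t + 1ℤ - 1ℤ ≡ t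
        cancel = solve-∀
      two-apart : t + 1ℤ + 1ℤ ≡ t + + 2 mod N
      two-apart = mod-reflexive (ℤ.+-assoc t 1ℤ 1ℤ)

    fixes-uᵉ-ℕ : ∀ (t : ℕ) → Fixed (uᵉ (+ t)) × Fixed (uᵉ (+ t + 1ℤ))
    fixes-uᵉ-ℕ ℕ.zero    = g-uᵉ₀ , g-uᵉ₁
    fixes-uᵉ-ℕ (ℕ.suc t) with fixes-uᵉ-ℕ t
    ... | fix₀ , fix₁ = subst Fixed (family-mod-cong U (λ p → p) (mod-reflexive (+t+1≡ t))) fix₁
                      , subst Fixed (family-mod-cong U (λ p → p) (mod-reflexive (cong (_+ 1ℤ) (+t+1≡ t))))
                                   (fixes-uᵉ-next (+ t) fix₀ fix₁)
      where
      +t+1≡ : ∀ t → + t + 1ℤ ≡ + ℕ.suc t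
      +t+1≡ t = cong +_ (ℕ.+-comm t 1)

    fixes-uᵉ : ∀ t → Fixed (uᵉ t)
    fixes-uᵉ t = subst Fixed (family-mod-cong U (λ p → p) (toFin-mod t)) (proj₁ (fixes-uᵉ-ℕ (toℕ (toFin t))))

    fixes-vᵒ : ∀ t → Fixed (vᵒ t)
    fixes-vᵒ t = spoke-partner-uᵉ {t} (subst (λ v → Spoke n v (g (vᵒ t))) (fixes-uᵉ t) (g-spoke (uᵉ-spoke t)))

    inner-neighbour-of-fixed : ∀ {v w} → Inner n k v w → Fixed w → Inner n k w (g v)
    inner-neighbour-of-fixed i fix = Inner-sym (subst (Inner n k _) fix (g-inner i))

    fixes-vᵉ : ∀ t → Fixed (vᵉ t)
    fixes-vᵉ t with inner-neighbour-vᵒ {t + K} (inner-neighbour-of-fixed (vᵉ-inner⁺ t) (fixes-vᵒ (t + K)))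
                  | inner-neighbour-vᵒ {t - K} (inner-neighbour-of-fixed (vᵉ-inner⁻ t) (fixes-vᵒ (t - K)))
    ... | inj₂ e | _       = trans e (family-mod-cong V (λ p → p) (mod-reflexive (+-sub t K)))
    ... | _      | inj₁ e  = trans e (family-mod-cong V (λ p → p) (mod-reflexive (-+-sub t K)))
    ... | inj₁ e | inj₂ e′ = ⊥-elim (vtx-≢ (+-≢ 4k≢0 (t - K - K) (mod-reflexive (regroup t K))) (trans (sym e′) e))
      where
      regroup : ∀ t K → t + K + K ≡ t - K - K + + 4 * K
      regroup = solve-∀

    fixes-uᵒ : ∀ t → Fixed (uᵒ t)
    fixes-uᵒ t = spoke-partner-vᵉ {t} (subst (λ v → Spoke n v (g (uᵒ t))) (fixes-vᵉ t) (g-spoke (vᵉ-spoke t)))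

    fixes-all : ∀ x → Fixed x
    fixes-all = families-cover Fixed fixes-uᵉ fixes-uᵒ fixes-vᵉ fixes-vᵒ

  module _ (2≢0 : ¬ + 2 ≡ 0ℤ mod N) (4k≢0 : ¬ + 4 * K ≡ 0ℤ mod N)
    {f : Vx → Vx} (f-injective : ∀ {x y} → f x ≡ f y → x ≡ y)
    (f-outer : f Preserves Outer n ⟶ Outer n) (f-inner : f Preserves Inner n k ⟶ Inner n k)
    (f-spoke : f Preserves Spoke n ⟶ Spoke n) where

    private
      c : ℤ
      c = idx (f (uᵉ 0ℤ))

      b : Bool
      b = layer (f (uᵉ 0ℤ))

      -- Normalise f by the affine map sending f(uᵉ 0), f(uᵉ 1) back to uᵉ 0, uᵉ 1.
      normalised-is-identity : ∀ fl → side (f (uᵉ 0ℤ)) ≡ U → side (f (uᵉ 1ℤ)) ≡ U → layer (f (uᵉ 1ℤ)) ≡ not b →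
        idx (f (uᵉ 1ℤ)) ≡ c + ±1 fl mod N → ∀ x → f x ≡ affine fl b c x
      normalised-is-identity fl s₀ s₁ l₁ i₁ x =
        trans (sym (affine-inverseʳ fl b c (f x))) (cong (affine fl b c) (R.fixes-all x))
        where
        c′ = - (±1 fl * c)
        g₀ : affine fl b c′ (f (uᵉ 0ℤ)) ≡ uᵉ 0ℤ
        g₀ = ≡-vtx U 0ℤ false s₀ (mod-trans (idx-affine fl b c′ (f (uᵉ 0ℤ))) (mod-reflexive (ℤ.+-inverseʳ (±1 fl * c))))
                   (xor-same b)
        g₁ : affine fl b c′ (f (uᵉ 1ℤ)) ≡ uᵉ 1ℤ
        g₁ = ≡-vtx U 1ℤ true s₁
          (mod-trans (idx-affine fl b c′ (f (uᵉ 1ℤ))) (mod-trans (+-mod-cong (*-mod-congˡ (±1 fl) i₁) mod-refl)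
            (mod-reflexive (trans (cancel (±1 fl) c) (±1-square fl)))))
          (trans (cong (b xor_) l₁) (xor-inverseʳ b))
          where
          cancel : ∀ s c → s * (c + s) + - (s * c) ≡ s * s
          cancel = solve-∀
        module R = Rigidity 2≢0 4k≢0 {affine fl b c′ ∘ f} (f-injective ∘ affine-injective fl b c′)
          (affine-preserves-Outer fl b c′ ∘ f-outer) (affine-preserves-Inner fl b c′ ∘ f-inner)
          (affine-preserves-Spoke fl b c′ ∘ f-spoke) g₀ g₁

    edge-type-preserving⇒affine : IsAffine f
    edge-type-preserving⇒affine with Outer⇒ (f-outer (uᵉ-outer 0ℤ))
    ... | s₀ , s₁ , l₁ , plus i₁  = false , b , c , normalised-is-identity false s₀ s₁ l₁ i₁
    ... | s₀ , s₁ , l₁ , minus i₁ = true , b , c , normalised-is-identity true s₀ s₁ l₁ i₁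

  distinct-outer-neighbours : ∀ {z a b} → Outer n z a → Outer n z b → ¬ a ≡ b →
                              idx b ≡ idx a + + 2 mod N ⊎ idx b ≡ idx a - + 2 mod N
  distinct-outer-neighbours {z} {a} {b} oa ob a≢b with Outer⇒ oa | Outer⇒ ob
  ... | _ , sa , la , plus ra  | _ , sb , lb , plus rb  =
    ⊥-elim (a≢b (vertex-≡ (trans sa (sym sb)) (mod-trans ra (mod-sym rb)) (trans la (sym lb))))
  ... | _ , sa , la , minus ra | _ , sb , lb , minus rb =
    ⊥-elim (a≢b (vertex-≡ (trans sa (sym sb)) (mod-trans ra (mod-sym rb)) (trans la (sym lb))))
  ... | _ , _ , _ , minus ra   | _ , _ , _ , plus rb    =
    inj₁ (mod-trans rb (mod-trans (+-mod-cong (≡-⇒≡+ {a = idx z} 1ℤ ra) (mod-refl {a = 1ℤ})) (mod-reflexive (up (idx a)))))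
    where
    up : ∀ a → a + 1ℤ + 1ℤ ≡ a + + 2
    up = solve-∀
  ... | _ , _ , _ , plus ra    | _ , _ , _ , minus rb   =
    inj₂ (mod-trans rb (mod-trans (+-mod-cong (≡+⇒≡- {a = idx z} 1ℤ ra) (mod-refl {a = -1ℤ})) (mod-reflexive (down (idx a)))))
    where
    down : ∀ a → a - 1ℤ - 1ℤ ≡ a - + 2
    down = solve-∀

module Automorphisms (m k h : ℕ) (n≡2h : ℕ.suc m ≡ 2 ℕ.* h) (k-even : + k ≡ 0ℤ mod + 2) where

  open import Data.Fin using (toℕ)
  open import Data.Bool.Properties using (not-involutive)
  open import Data.Integer hiding (suc; _≤_; _<_)
  import Data.Integer.Properties as ℤ
  open import Data.Integer.Tactic.RingSolver using (solve-∀)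
  open Congruence
  open Signs
  open Sides

  open VertexFamilies m k h n≡2h k-even public

  Adj-invariant-constant : ∀ {A : Set} (φ : Vx → A) → φ Preserves Adj n k ⟶ _≡_ → ∀ x → φ x ≡ φ (uᵉ 0ℤ)
  Adj-invariant-constant φ φ-inv = families-cover (λ x → φ x ≡ φ (uᵉ 0ℤ)) along-uᵉ along-uᵒ along-vᵉ along-vᵒ
    where
    along-uᵉ-ℕ : ∀ (t : ℕ) → φ (uᵉ (+ t)) ≡ φ (uᵉ 0ℤ)
    along-uᵉ-ℕ ℕ.zero    = refl
    along-uᵉ-ℕ (ℕ.suc t) = trans (cong φ (family-mod-cong U (λ p → p) (mod-reflexive (cong +_ (ℕ.+-comm 1 t)))))
                                  (trans (sym (φ-inv (inj₁ (uᵉ-outer (+ t))))) (along-uᵉ-ℕ t))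
    along-uᵉ : ∀ t → φ (uᵉ t) ≡ φ (uᵉ 0ℤ)
    along-uᵉ t = trans (cong φ (family-mod-cong U (λ p → p) (mod-sym (toFin-mod t)))) (along-uᵉ-ℕ (toℕ (toFin t)))
    along-vᵒ : ∀ t → φ (vᵒ t) ≡ φ (uᵉ 0ℤ)
    along-vᵒ t = trans (sym (φ-inv (inj₂ (inj₂ (uᵉ-spoke t))))) (along-uᵉ t)
    along-vᵉ : ∀ t → φ (vᵉ t) ≡ φ (uᵉ 0ℤ)
    along-vᵉ t = trans (φ-inv (inj₂ (inj₁ (vᵉ-inner⁺ t)))) (along-vᵒ (t + K))
    along-uᵒ : ∀ t → φ (uᵒ t) ≡ φ (uᵉ 0ℤ)
    along-uᵒ t = trans (sym (φ-inv (inj₂ (inj₂ (vᵉ-spoke t))))) (along-vᵉ t)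

  Outer-sides : ∀ {x y} → Outer n x y → side x ≡ U × side y ≡ U
  Outer-sides o = let (sx , sy , _) = Outer⇒ o in sx , sy

  Inner-sides : ∀ {x y} → Inner n k x y → side x ≡ V × side y ≡ V
  Inner-sides i = let (sx , sy , _) = Inner⇒ i in sx , sy

  Outer-not-Spoke : ∀ {x y} → Outer n x y → ¬ Spoke n x y
  Outer-not-Spoke {x} o s with Outer-sides o
  ... | sx , sy = opp-≢ (side x) (trans sx (trans (sym sy) (proj₁ (Spoke⇒ s))))

  Inner-not-Spoke : ∀ {x y} → Inner n k x y → ¬ Spoke n x y
  Inner-not-Spoke {x} i s with Inner-sides i
  ... | sx , sy = opp-≢ (side x) (trans sx (trans (sym sy) (proj₁ (Spoke⇒ s))))

  U≢V : ¬ U ≡ V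
  U≢V ()

  module InB (σ : Perm Vx) (σ∈B : B n k σ) where

    s : Vx → Vx
    s = to σ

    adj⇒ : ∀ {x y} → Adj n k x y → Adj n k (s x) (s y)
    adj⇒ = Equivalence.to (proj₁ σ∈B _ _)

    adj⇐ : ∀ {x y} → Adj n k (s x) (s y) → Adj n k x y
    adj⇐ = Equivalence.from (proj₁ σ∈B _ _)

    spoke⇒ : ∀ {x y} → Spoke n x y → Spoke n (s x) (s y)
    spoke⇒ = Equivalence.to (proj₂ σ∈B _ _)

    spoke⇐ : ∀ {x y} → Spoke n (s x) (s y) → Spoke n x y
    spoke⇐ = Equivalence.from (proj₂ σ∈B _ _)

    non-spoke⇒ : ∀ {x y} → ¬ Spoke n x y → Adj n k x y → Outer n (s x) (s y) ⊎ Inner n k (s x) (s y)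
    non-spoke⇒ ¬sp a with adj⇒ a
    ... | inj₁ o        = inj₁ o
    ... | inj₂ (inj₁ i) = inj₂ i
    ... | inj₂ (inj₂ sp) = ⊥-elim (¬sp (spoke⇐ sp))

    non-spoke-sides : ∀ {x y} → Outer n x y ⊎ Inner n k x y → side x ≡ side y
    non-spoke-sides (inj₁ o) = trans (proj₁ (Outer-sides o)) (sym (proj₂ (Outer-sides o)))
    non-spoke-sides (inj₂ i) = trans (proj₁ (Inner-sides i)) (sym (proj₂ (Inner-sides i)))

    relative-side : Vx → Side
    relative-side x = relative (side x) (side (s x))

    relative-side-invariant : relative-side Preserves Adj n k ⟶ _≡_
    relative-side-invariant a@(inj₁ o) =
      cong₂ relative (non-spoke-sides (inj₁ o)) (non-spoke-sides (non-spoke⇒ (Outer-not-Spoke o) a))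
    relative-side-invariant a@(inj₂ (inj₁ i)) =
      cong₂ relative (non-spoke-sides (inj₂ i)) (non-spoke-sides (non-spoke⇒ (Inner-not-Spoke i) a))
    relative-side-invariant {x} {y} (inj₂ (inj₂ sp)) = sym (trans
      (cong₂ relative (proj₁ (Spoke⇒ sp)) (proj₁ (Spoke⇒ (spoke⇒ sp)))) (relative-opp (side x) (side (s x))))

    keeps-or-swaps-sides : (∀ x → side (s x) ≡ side x) ⊎ (∀ x → side (s x) ≡ opp (side x))
    keeps-or-swaps-sides with relative-side (uᵉ 0ℤ) in e
    ... | U = inj₁ λ x → relative-U _ _ (trans (Adj-invariant-constant relative-side relative-side-invariant x) e)
    ... | V = inj₂ λ x → relative-V _ _ (trans (Adj-invariant-constant relative-side relative-side-invariant x) e)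

    module SideKeeping (keeps : ∀ x → side (s x) ≡ side x) where

      outer⇒ : ∀ {x y} → Outer n x y → Outer n (s x) (s y)
      outer⇒ {x} {y} o with non-spoke⇒ (Outer-not-Spoke o) (inj₁ o)
      ... | inj₁ o′ = o′
      ... | inj₂ i′ = ⊥-elim (U≢V (trans (sym (proj₁ (Outer-sides o))) (trans (sym (keeps x)) (proj₁ (Inner-sides i′)))))

      outer⇐ : ∀ {x y} → Outer n (s x) (s y) → Outer n x y
      outer⇐ {x} {y} o′ with adj⇐ (inj₁ o′)
      ... | inj₁ o         = o
      ... | inj₂ (inj₁ i)  = ⊥-elim (U≢V (trans (sym (proj₁ (Outer-sides o′))) (trans (keeps x) (proj₁ (Inner-sides i)))))
      ... | inj₂ (inj₂ sp) = ⊥-elim (Outer-not-Spoke o′ (spoke⇒ sp))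

      inner⇒ : ∀ {x y} → Inner n k x y → Inner n k (s x) (s y)
      inner⇒ {x} {y} i with non-spoke⇒ (Inner-not-Spoke i) (inj₂ (inj₁ i))
      ... | inj₂ i′ = i′
      ... | inj₁ o′ = ⊥-elim (U≢V (trans (sym (proj₁ (Outer-sides o′))) (trans (keeps x) (proj₁ (Inner-sides i)))))

      inner⇐ : ∀ {x y} → Inner n k (s x) (s y) → Inner n k x y
      inner⇐ {x} {y} i′ with adj⇐ (inj₂ (inj₁ i′))
      ... | inj₂ (inj₁ i)  = i
      ... | inj₁ o         = ⊥-elim (U≢V (trans (sym (proj₁ (Outer-sides o))) (trans (sym (keeps x)) (proj₁ (Inner-sides i′)))))
      ... | inj₂ (inj₂ sp) = ⊥-elim (Inner-not-Spoke i′ (spoke⇒ sp))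

      ∈C : C n k σ
      ∈C = proj₁ σ∈B , (λ x y → mk⇔ outer⇒ outer⇐) , (λ x y → mk⇔ inner⇒ inner⇐) , proj₂ σ∈B

    module SideSwapping (swaps : ∀ x → side (s x) ≡ opp (side x)) where

      outer⇒inner : ∀ {x y} → Outer n x y → Inner n k (s x) (s y)
      outer⇒inner {x} {y} o with non-spoke⇒ (Outer-not-Spoke o) (inj₁ o)
      ... | inj₂ i′ = i′
      ... | inj₁ o′ = ⊥-elim (U≢V (trans (sym (proj₁ (Outer-sides o′))) (trans (swaps x) (cong opp (proj₁ (Outer-sides o))))))

      inner⇒outer : ∀ {x y} → Inner n k x y → Outer n (s x) (s y)
      inner⇒outer {x} {y} i with non-spoke⇒ (Inner-not-Spoke i) (inj₂ (inj₁ i))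
      ... | inj₁ o′ = o′
      ... | inj₂ i′ = ⊥-elim (U≢V (trans (sym (cong opp (proj₁ (Inner-sides i))))
                                       (trans (sym (swaps x)) (proj₁ (Inner-sides i′)))))

      ∉C : ¬ C n k σ
      ∉C (_ , σ-outer , _) = U≢V (trans (sym (proj₁ (Outer-sides (Equivalence.to (σ-outer _ _) (uᵉ-outer 0ℤ)))))
                                        (swaps (uᵉ 0ℤ)))

      module _ (2≢0 : ¬ + 2 ≡ 0ℤ mod N) (2k≢0 : ¬ + 2 * K ≡ 0ℤ mod N) where

        private
          s-injective : ∀ {x y} → s x ≡ s y → x ≡ y
          s-injective {x} {y} e = trans (sym (from∘to σ x)) (trans (cong (from σ) e) (from∘to σ y))

          -- s maps the outer cycle uᵒ onto a closed walk along inner edges.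
          hs : ℤ → ℤ
          hs t = idx (s (uᵒ t))

          image-step : ∀ t → Step K (s (uᵒ t)) (s (uᵒ (t + 1ℤ)))
          image-step t = proj₂ (proj₂ (Inner⇒ (outer⇒inner (uᵒ-outer t))))

          hs-mod-cong : ∀ {a b} → a ≡ b mod N → hs a ≡ hs b mod N
          hs-mod-cong c = idx-cong (cong s (family-mod-cong U not c))

          no-backtracking : ∀ t d → hs (t + 1ℤ) ≡ hs t + d mod N → ¬ hs (t + 1ℤ + 1ℤ) ≡ hs (t + 1ℤ) - d mod N
          no-backtracking t d fwd back = vtx-≢ (+-≢ 2≢0 t (mod-reflexive (ℤ.+-assoc t 1ℤ 1ℤ)))
            (sym (s-injective (vertex-≡ (trans (swaps _) (sym (swaps _)))
              (mod-trans back (mod-trans (+-mod-cong fwd (mod-refl {a = - d})) (mod-reflexive (+-sub (hs t) d))))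
              (trans (proj₁ (image-step (t + 1ℤ))) (trans (cong not (proj₁ (image-step t))) (not-involutive _))))))

          module Linear (d : ℤ) (related : ∀ t → ±-Related d (hs t) (hs (t + 1ℤ)))
                        (first : hs 1ℤ ≡ hs 0ℤ + d mod N) where

            suc≡ : ∀ t → + t + 1ℤ ≡ + ℕ.suc t
            suc≡ t = cong +_ (ℕ.+-comm t 1)

            steady : ∀ (t : ℕ) → hs (+ t + 1ℤ) ≡ hs (+ t) + d mod N
            steady ℕ.zero = first
            steady (ℕ.suc t) with related (+ ℕ.suc t)
            ... | plus r  = r
            ... | minus r = ⊥-elim (no-backtracking (+ t) d (steady t) (mod-trans step (mod-trans r
                              (+-mod-cong (hs-mod-cong (mod-reflexive (sym (suc≡ t)))) (mod-refl {a = - d})))))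
              where
              step : hs (+ t + 1ℤ + 1ℤ) ≡ hs (+ ℕ.suc t + 1ℤ) mod N
              step = hs-mod-cong (mod-reflexive (cong (_+ 1ℤ) (suc≡ t)))

            linear : ∀ (t : ℕ) → hs (+ t) ≡ hs 0ℤ + + t * d mod N
            linear ℕ.zero    = mod-reflexive (sym (trans (cong (λ u → hs 0ℤ + u) (ℤ.*-zeroˡ d)) (ℤ.+-identityʳ (hs 0ℤ))))
            linear (ℕ.suc t) = begin
              hs (+ ℕ.suc t)           ≈⟨ hs-mod-cong (mod-reflexive (cong +_ (ℕ.+-comm 1 t))) ⟩
              hs (+ t + 1ℤ)            ≈⟨ steady t ⟩
              hs (+ t) + d             ≈⟨ +-mod-cong (linear t) (mod-refl {a = d}) ⟩
              hs 0ℤ + + t * d + d      ≡⟨ regroup (hs 0ℤ) (+ t) d ⟩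
              hs 0ℤ + (+ t + 1ℤ) * d   ≡⟨ cong (λ u → hs 0ℤ + u * d) (cong +_ (ℕ.+-comm t 1)) ⟩
              hs 0ℤ + + ℕ.suc t * d    ∎
              where
              open import Relation.Binary.Reasoning.Setoid (mod-setoid {N})
              regroup : ∀ h t d → h + t * d + d ≡ h + (t + 1ℤ) * d
              regroup = solve-∀

            T : ℤ
            T = + 2 * K

            idx-image-vᵉ : ∀ t → idx (s (vᵉ t)) ≡ hs t mod N
            idx-image-vᵉ t = mod-sym (proj₂ (proj₂ (Spoke⇒ (spoke⇒ (vᵉ-spoke t)))))

            z : Vx
            z = s (vᵒ (0ℤ + K))

            z-outer₀ : Outer n z (s (vᵉ 0ℤ))
            z-outer₀ = Outer-sym (inner⇒outer (vᵉ-inner⁺ 0ℤ))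

            z-outer₁ : Outer n z (s (vᵉ T))
            z-outer₁ = Outer-sym (subst (λ v → Outer n (s (vᵉ T)) (s v))
              (family-mod-cong V not (mod-reflexive (back K))) (inner⇒outer (vᵉ-inner⁻ T)))
              where
              back : ∀ K → + 2 * K - K ≡ 0ℤ + K
              back = solve-∀

            images-distinct : ¬ s (vᵉ 0ℤ) ≡ s (vᵉ T)
            images-distinct e = vtx-≢ (+-≢ 2k≢0 0ℤ (mod-reflexive (sym (ℤ.+-identityˡ T)))) (s-injective e)

            shift : ∀ {e} → idx (s (vᵉ T)) ≡ idx (s (vᵉ 0ℤ)) + e mod N → T * d ≡ e mod N
            shift {e} r = +-mod-cancelˡ (hs 0ℤ) (begin
              hs 0ℤ + T * d                 ≈⟨ +-mod-cong (mod-refl {a = hs 0ℤ}) (*-mod-congʳ d (mod-reflexive (ℤ.pos-* 2 k))) ⟨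
              hs 0ℤ + + (2 ℕ.* k) * d       ≈⟨ linear (2 ℕ.* k) ⟨
              hs (+ (2 ℕ.* k))              ≈⟨ hs-mod-cong (mod-reflexive (ℤ.pos-* 2 k)) ⟩
              hs T                          ≈⟨ idx-image-vᵉ T ⟨
              idx (s (vᵉ T))                ≈⟨ r ⟩
              idx (s (vᵉ 0ℤ)) + e           ≈⟨ +-mod-cong (idx-image-vᵉ 0ℤ) (mod-refl {a = e}) ⟩
              hs 0ℤ + e                     ∎)
              where open import Relation.Binary.Reasoning.Setoid (mod-setoid {N})

            Td≡±2 : Σ Bool λ f → T * d ≡ ±1 f * + 2 mod N
            Td≡±2 with distinct-outer-neighbours z-outer₀ z-outer₁ images-distinct
            ... | inj₁ r = false , shift r
            ... | inj₂ r = true , shift r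

        2k²≡±2 : Σ Bool λ f → + 2 * K * K ≡ ±1 f * + 2 mod N
        2k²≡±2 with proj₂ (image-step 0ℤ)
        ... | plus r = Linear.Td≡±2 K (λ t → proj₂ (image-step t)) r
        ... | minus r with Linear.Td≡±2 (- K) (λ t → ±-Related-neg (proj₂ (image-step t))) r
        ...   | f , c = not f , mod-trans (mod-reflexive (negate K)) (mod-trans (neg-mod-cong c) (mod-reflexive (flip f)))
          where
          negate : ∀ K → + 2 * K * K ≡ - (+ 2 * K * - K)
          negate = solve-∀
          flip : ∀ f → - (±1 f * + 2) ≡ ±1 (not f) * + 2
          flip false = refl
          flip true  = refl

        swapping⇒k²≡±1 : Σ Bool λ f → K * K ≡ ±1 f mod H
        swapping⇒k²≡±1 with 2k²≡±2
        ... | f , c = f , mod-halve (subst (λ D → K * K * + 2 ≡ ±1 f * + 2 mod D) N≡2H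
                                            (mod-trans (mod-reflexive (reorder K)) c))
          where
          reorder : ∀ K → K * K * + 2 ≡ + 2 * K * K
          reorder = solve-∀

module Theorem (m k h : ℕ) (n≡2h : ℕ.suc m ≡ 2 ℕ.* h) (k-even : + k ≡ 0ℤ mod + 2)
               (2≤k : 2 ℕ.≤ k) (k<h : k ℕ.< h) where

  open import Data.Nat using (_≤_; _<_; s≤s; z≤n)
  import Data.Nat.Divisibility as ℕ
  open import Relation.Nullary.Decidable using (decidable-stable; _⊎-dec_; map′)
  open import Data.Integer hiding (suc; _≤_; _<_)
  import Data.Integer.Properties as ℤ
  open import Data.Integer.Tactic.RingSolver using (solve-∀)
  open Congruence
  open Signs
  open Sides
  open Permutations

  open Automorphisms m k h n≡2h k-even

  3≤h : 3 ≤ h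
  3≤h = ℕ.≤-trans (s≤s 2≤k) k<h

  instance
    h-nonZero : ℕ.NonZero h
    h-nonZero = ℕ.>-nonZero (ℕ.≤-trans (s≤s z≤n) 3≤h)

  2≢0 : ¬ + 2 ≡ 0ℤ mod N
  2≢0 = positive<mod⇒≢0 n (s≤s z≤n)
    (subst (2 <_) (sym n≡2h) (ℕ.≤-trans (s≤s (s≤s (s≤s z≤n))) (ℕ.*-monoʳ-≤ 2 3≤h)))

  2k≢0 : ¬ + 2 * K ≡ 0ℤ mod N
  2k≢0 c = positive<mod⇒≢0 n (ℕ.≤-trans (s≤s z≤n) (ℕ.*-monoʳ-≤ 2 2≤k))
    (subst (2 ℕ.* k <_) (sym n≡2h) (ℕ.*-monoʳ-< 2 k<h))
             (subst (λ z → z ≡ 0ℤ mod N) (sym (ℤ.pos-* 2 k)) c)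

  -- 4k ≡ 0 (mod 2h) would give 2k ≡ 0 (mod h), hence ±2 ≡ 2k² ≡ 0 (mod h), impossible as h > 2.
  4k≢0 : ∀ {f} → K * K ≡ ±1 f mod H → ¬ + 4 * K ≡ 0ℤ mod N
  4k≢0 {f} k²≡e 4k≡0 = ±2≢0 f (begin
    + 2 * ±1 f       ≈⟨ *-mod-congˡ (+ 2) k²≡e ⟨
    + 2 * (K * K)    ≡⟨ regroup K ⟩
    (+ 2 * K) * K    ≈⟨ *-mod-congʳ K 2k≡0 ⟩
    0ℤ * K           ≡⟨ ℤ.*-zeroˡ K ⟩
    0ℤ               ∎)
    where
    open import Relation.Binary.Reasoning.Setoid (mod-setoid {H})
    regroup : ∀ K → + 2 * (K * K) ≡ (+ 2 * K) * K
    regroup = solve-∀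
    2k≡0 : + 2 * K ≡ 0ℤ mod H
    2k≡0 = mod-halve (subst (λ D → (+ 2 * K) * + 2 ≡ 0ℤ mod D) N≡2H
                             (mod-trans (mod-reflexive (double K)) 4k≡0))
      where
      double : ∀ K → (+ 2 * K) * + 2 ≡ + 4 * K
      double = solve-∀
    ±2≢0 : ∀ f → ¬ + 2 * ±1 f ≡ 0ℤ mod H
    ±2≢0 false c = positive<mod⇒≢0 h (s≤s z≤n) (ℕ.≤-trans (s≤s (s≤s (s≤s z≤n))) 3≤h) c
    ±2≢0 true  c = positive<mod⇒≢0 h (s≤s z≤n) (ℕ.≤-trans (s≤s (s≤s (s≤s z≤n))) 3≤h) (neg-mod-cong c)

  Condition : Set
  Condition = Σ Bool λ f → K * K ≡ ±1 f mod H

  SwapsSides : Perm Vx → Set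
  SwapsSides σ = ∀ x → side (to σ x) ≡ opp (side x)

  perm-injective : ∀ (σ : Perm Vx) {x y} → to σ x ≡ to σ y → x ≡ y
  perm-injective σ {x} {y} e = trans (sym (from∘to σ x)) (trans (cong (from σ) e) (from∘to σ y))

  B-dichotomy : ∀ σ → B n k σ → C n k σ ⊎ (Condition × SwapsSides σ)
  B-dichotomy σ σ∈B with InB.keeps-or-swaps-sides σ σ∈B
  ... | inj₁ keeps = inj₁ (InB.SideKeeping.∈C σ σ∈B keeps)
  ... | inj₂ swaps = inj₂ (InB.SideSwapping.swapping⇒k²≡±1 σ σ∈B swaps 2≢0 2k≢0 , swaps)

  opaque
    C⊆affine : Condition → ∀ σ → C n k σ → IsAffine (to σ)
    C⊆affine (_ , k²≡e) σ (_ , σ-outer , σ-inner , σ-spoke) = edge-type-preserving⇒affine 2≢0 (4k≢0 k²≡e)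
      (perm-injective σ) (stabilises⇒preserves σ σ-outer) (stabilises⇒preserves σ σ-inner)
      (stabilises⇒preserves σ σ-spoke)

  module WithTwist (f : Bool) (k²≡e : K * K ≡ ±1 f mod H) where

    open TwistMap f k²≡e

    -- tw² preserves every edge type, so it is affine; this provides the inverse of tw.
    opaque
      tw²-affine : IsAffine (tw ∘ tw)
      tw²-affine = edge-type-preserving⇒affine 2≢0 (4k≢0 k²≡e) (tw-injective ∘ tw-injective)
        (tw-Inner⇒Outer ∘ tw-Outer⇒Inner) (tw-Outer⇒Inner ∘ tw-Inner⇒Outer) (tw-Spoke⇒Spoke ∘ tw-Spoke⇒Spoke)

    tw-preserves-Adj : tw Preserves Adj n k ⟶ Adj n k
    tw-preserves-Adj (inj₁ o)        = inj₂ (inj₁ (tw-Outer⇒Inner o))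
    tw-preserves-Adj (inj₂ (inj₁ i)) = inj₁ (tw-Inner⇒Outer i)
    tw-preserves-Adj (inj₂ (inj₂ s)) = inj₂ (inj₂ (tw-Spoke⇒Spoke s))

    module Inverse (fl b : Bool) (c : ℤ) (tw²≡ : ∀ x → tw (tw x) ≡ affine fl b c x) where

      tw⁻¹ : Vx → Vx
      tw⁻¹ = affine fl b (- (±1 fl * c)) ∘ tw

      tw⁻¹∘tw : ∀ x → tw⁻¹ (tw x) ≡ x
      tw⁻¹∘tw x = trans (cong (affine fl b _) (tw²≡ x)) (affine-inverseˡ fl b c x)

      tw∘tw⁻¹ : ∀ x → tw (tw⁻¹ x) ≡ x
      tw∘tw⁻¹ x = trans (cong (tw ∘ tw⁻¹) x≡tw²v) (trans (cong tw (tw⁻¹∘tw (tw v))) (sym x≡tw²v))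
        where
        v = affine fl b (- (±1 fl * c)) x
        x≡tw²v : x ≡ tw (tw v)
        x≡tw²v = trans (sym (affine-inverseʳ fl b c x)) (sym (tw²≡ v))

      twPerm : Perm Vx
      twPerm = record { to = tw ; from = tw⁻¹ ; from∘to = tw⁻¹∘tw ; to∘from = tw∘tw⁻¹ }

      twPerm∈B : B n k twPerm
      twPerm∈B = preserves⇒stabilises {R = Adj n k} twPerm tw-preserves-Adj (affine-preserves-Adj ∘ tw-preserves-Adj)
               , preserves⇒stabilises {R = Spoke n} twPerm tw-Spoke⇒Spoke (affine-preserves-Spoke fl b _ ∘ tw-Spoke⇒Spoke)
        where
        affine-preserves-Adj = preserves-Adj {affine fl b (- (±1 fl * c))} (affine-preserves-Outer fl b _)
                                 (affine-preserves-Inner fl b _) (affine-preserves-Spoke fl b _)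

    open Inverse (proj₁ tw²-affine) (proj₁ (proj₂ tw²-affine)) (proj₁ (proj₂ (proj₂ tw²-affine)))
                 (proj₂ (proj₂ (proj₂ tw²-affine)))

    swapping·tw∈C : ∀ σ → B n k σ → SwapsSides σ → C n k (σ · twPerm)
    swapping·tw∈C σ σ∈B swaps = InB.SideKeeping.∈C (σ · twPerm) (·-closed (B-closed n k) {σ} {twPerm} σ∈B twPerm∈B)
      λ x → trans (side-tw (to σ x)) (trans (cong opp (swaps x)) (opp-involutive (side x)))
      where open SubgroupClosed

    B≐⟨G⟩ : ∀ G → C n k ⊆ ⟨ G ⟩ → ⟨ G ⟩ twPerm → G ⊆ B n k → B n k ≐ ⟨ G ⟩
    B≐⟨G⟩ G C⊆⟨G⟩ tw∈⟨G⟩ G⊆B σ = mk⇔ (λ σ∈B → B⊆⟨G⟩ σ∈B (B-dichotomy σ σ∈B)) (⟨⟩-least (B-closed n k) G⊆B)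
      where
      B⊆⟨G⟩ : B n k σ → C n k σ ⊎ (Condition × SwapsSides σ) → ⟨ G ⟩ σ
      B⊆⟨G⟩ _ (inj₁ σ∈C) = C⊆⟨G⟩ {σ} σ∈C
      B⊆⟨G⟩ σ∈B (inj₂ (_ , swaps)) =
        ext {σ = (σ · twPerm) · (twPerm ⁻¹)} (mul (C⊆⟨G⟩ {σ · twPerm} (swapping·tw∈C σ σ∈B swaps)) (inv tw∈⟨G⟩))
            (λ x → tw⁻¹∘tw (to σ x))

    tw-generates : ⟦ tw ⟧ twPerm
    tw-generates x = refl

    twPerm∉C : ¬ C n k twPerm
    twPerm∉C = InB.SideSwapping.∉C twPerm twPerm∈B side-tw

    B≢C : ¬ (B n k ≐ C n k)
    B≢C B≐C = twPerm∉C (Equivalence.to (B≐C twPerm) twPerm∈B)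

    B≐⟨C∪tw⟩ : B n k ≐ ⟨ C n k ∪ ⟦ tw ⟧ ⟩
    B≐⟨C∪tw⟩ = B≐⟨G⟩ (C n k ∪ ⟦ tw ⟧) (λ {σ} σ∈C → gen {σ = σ} (inj₁ σ∈C)) (gen {σ = twPerm} (inj₂ tw-generates))
                     (λ {π} → G⊆B {π})
      where
      G⊆B : C n k ∪ ⟦ tw ⟧ ⊆ B n k
      G⊆B {π} (inj₁ π∈C)  = C⊆B {n} {k} {π} π∈C
      G⊆B {π} (inj₂ π≡tw) = SubgroupClosed.≈-closed (B-closed n k) {twPerm} {π} twPerm∈B (λ x → sym (π≡tw x))

    B≐⟨ρδβtw⟩ : B n k ≐ ⟨ RDB+ n tw ⟩
    B≐⟨ρδβtw⟩ = B≐⟨G⟩ (RDB+ n tw) (λ {σ} → C⊆⟨ρδβtw⟩ {σ}) (gen {σ = twPerm} (inj₂ (inj₂ (inj₂ tw-generates))))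
                      (λ {π} → G⊆B {π})
      where
      affine⊆⟨ρδβtw⟩ : ∀ σ → IsAffine (to σ) → ⟨ RDB+ n tw ⟩ σ
      affine⊆⟨ρδβtw⟩ σ (fl , b , c , σ≡) =
        ext {σ = affinePerm fl b c} {π = σ} (affine∈⟨ρδβ⟩ tw fl b c) (λ x → sym (σ≡ x))
      C⊆⟨ρδβtw⟩ : C n k ⊆ ⟨ RDB+ n tw ⟩
      C⊆⟨ρδβtw⟩ {σ} σ∈C = affine⊆⟨ρδβtw⟩ σ (C⊆affine (f , k²≡e) σ σ∈C)
      affine-like∈B : ∀ fl b c {g π} → (∀ x → affine fl b c x ≡ g x) → ⟦ g ⟧ π → B n k π
      affine-like∈B fl b c {π = π} e p = SubgroupClosed.≈-closed (B-closed n k) {affinePerm fl b c} {π}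
        (C⊆B {n} {k} {affinePerm fl b c} (affine∈C fl b c)) (λ x → trans (e x) (sym (p x)))
      G⊆B : RDB+ n tw ⊆ B n k
      G⊆B {π} (inj₁ p)               = affine-like∈B false false 1ℤ {π = π} ρ-affine p
      G⊆B {π} (inj₂ (inj₁ p))        = affine-like∈B true false 0ℤ {π = π} δ-affine p
      G⊆B {π} (inj₂ (inj₂ (inj₁ p))) = affine-like∈B false true 0ℤ {π = π} β-affine p
      G⊆B {π} (inj₂ (inj₂ (inj₂ p))) = SubgroupClosed.≈-closed (B-closed n k) {twPerm} {π} twPerm∈B (λ x → sym (p x))

  k²≡1⇔∣ : K * K ≡ 1ℤ mod H ⇔ h ℕ.∣ k ℕ.* k ℕ.∸ 1
  k²≡1⇔∣ = subst (λ z → z ≡ 1ℤ mod H ⇔ h ℕ.∣ k ℕ.* k ℕ.∸ 1) (ℤ.pos-* k k) (≡-mod⇔∣∸ 1≤k²)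
    where
    1≤k² : 1 ≤ k ℕ.* k
    1≤k² = ℕ.*-mono-≤ {1} {k} {1} {k} (ℕ.≤-trans (s≤s z≤n) 2≤k) (ℕ.≤-trans (s≤s z≤n) 2≤k)

  k²≡-1⇔∣ : K * K ≡ -1ℤ mod H ⇔ h ℕ.∣ k ℕ.* k ℕ.+ 1
  k²≡-1⇔∣ = subst (λ z → z ≡ -1ℤ mod H ⇔ h ℕ.∣ k ℕ.* k ℕ.+ 1) (ℤ.pos-* k k) ≡-mod⇔∣+

  Condition⇔∣ : Condition ⇔ (h ℕ.∣ k ℕ.* k ℕ.∸ 1 ⊎ h ℕ.∣ k ℕ.* k ℕ.+ 1)
  Condition⇔∣ = mk⇔ divides divided
    where
    divides : Condition → h ℕ.∣ k ℕ.* k ℕ.∸ 1 ⊎ h ℕ.∣ k ℕ.* k ℕ.+ 1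
    divides (false , c) = inj₁ (Equivalence.to k²≡1⇔∣ c)
    divides (true  , c) = inj₂ (Equivalence.to k²≡-1⇔∣ c)
    divided : h ℕ.∣ k ℕ.* k ℕ.∸ 1 ⊎ h ℕ.∣ k ℕ.* k ℕ.+ 1 → Condition
    divided (inj₁ d) = false , Equivalence.from k²≡1⇔∣ d
    divided (inj₂ d) = true  , Equivalence.from k²≡-1⇔∣ d

  ¬Condition⇒B≐C : ¬ Condition → B n k ≐ C n k
  ¬Condition⇒B≐C ¬cond σ = mk⇔ (λ σ∈B → in-C (B-dichotomy σ σ∈B)) (C⊆B {n} {k} {σ})
    where
    in-C : C n k σ ⊎ (Condition × SwapsSides σ) → C n k σ
    in-C (inj₁ σ∈C)       = σ∈C
    in-C (inj₂ (cond , _)) = ⊥-elim (¬cond cond)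

  B≢C⇒Condition : ¬ (B n k ≐ C n k) → Condition
  B≢C⇒Condition B≢C = decidable-stable
    (map′ (Equivalence.from Condition⇔∣) (Equivalence.to Condition⇔∣) ((h ℕ.∣? _) ⊎-dec (h ℕ.∣? _)))
    (B≢C ∘ ¬Condition⇒B≐C)

  theorem : ((¬ (B n k ≐ C n k)) ⇔ (h ℕ.∣ k ℕ.* k ℕ.∸ 1 ⊎ h ℕ.∣ k ℕ.* k ℕ.+ 1))
    × (h ℕ.∣ k ℕ.* k ℕ.∸ 1 → (B n k ≐ ⟨ C n k ∪ ⟦ λ-map n k ⟧ ⟩) × (B n k ≐ ⟨ RDB+ n (λ-map n k) ⟩))
    × (h ℕ.∣ k ℕ.* k ℕ.+ 1 → (B n k ≐ ⟨ C n k ∪ ⟦ τ-map n k ⟧ ⟩) × (B n k ≐ ⟨ RDB+ n (τ-map n k) ⟩))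
  theorem =
    mk⇔ (Equivalence.to Condition⇔∣ ∘ B≢C⇒Condition)
        (λ d → let (f , c) = Equivalence.from Condition⇔∣ d in WithTwist.B≢C f c) ,
    (λ d → let c = Equivalence.from k²≡1⇔∣ d in WithTwist.B≐⟨C∪tw⟩ false c , WithTwist.B≐⟨ρδβtw⟩ false c) ,
    (λ d → let c = Equivalence.from k²≡-1⇔∣ d in WithTwist.B≐⟨C∪tw⟩ true c , WithTwist.B≐⟨ρδβtw⟩ true c)

open import Data.Nat using (ℕ; _*_; _+_; _∸_; _/_; _≤_; _<_)
open import Data.Nat.Divisibility using (_∣_; ∣⇒≤)
open import Data.Product using (_×_)
open import Data.Sum using (_⊎_)
open import Relation.Nullary using (¬_)
open import Function.Bundles using (_⇔_)
open import Data.Nat.DivMod using (m*[n/m]≡n)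

lemma5p4 : (n k : ℕ) → 2 ∣ n → 2 ∣ k → 1 ≤ k → k < n / 2 →
    ((¬ (B n k ≐ C n k)) ⇔ ((n / 2 ∣ k * k ∸ 1) ⊎ (n / 2 ∣ k * k + 1)))
    × ((n / 2 ∣ k * k ∸ 1) →
         (B n k ≐ ⟨ C n k ∪ ⟦ λ-map n k ⟧ ⟩) × (B n k ≐ ⟨ RDB+ n (λ-map n k) ⟩))
    × ((n / 2 ∣ k * k + 1) →
         (B n k ≐ ⟨ C n k ∪ ⟦ τ-map n k ⟧ ⟩) × (B n k ≐ ⟨ RDB+ n (τ-map n k) ⟩))
lemma5p4 ℕ.zero k _ _ _ ()
lemma5p4 n@(ℕ.suc m) k 2∣n 2∣k 1≤k k<n/2 =
  Theorem.theorem m k (n / 2) (sym (m*[n/m]≡n 2∣n)) (Equivalence.from Congruence.≡0-mod⇔∣ 2∣k)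
                  (∣⇒≤ {{ℕ.>-nonZero 1≤k}} 2∣k) k<n/2
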